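{- Any linear symmetry of $C$ (i.e. any invertible linear map $F:\mathbb{Z}^6\to\mathbb{Z}^6$ with $C\circ F=C$) is necessarily a linear symmetry of the chamber complex, i.e. an invertible linear map from $\mathbb{Z}^6$ to itself that permutes the cells of the chamber complex.
   Context: Let $c^{\nu}_{\lambda\mu}$ denote the Littlewood--Richardson coefficients. Define $C:\mathbb{Z}^6\to\mathbb{Z}$ by $C(\lambda_1,\lambda_2,\mu_1,\mu_2,\nu_1,\nu_2)=c^{(\nu_1,\nu_2,\nu_3)}_{(\lambda_1,\lambda_2),(\mu_1,\mu_2)}$ with $\nu_3=\lambda_1+\lambda_2+\mu_1+\mu_2-\nu_1-\nu_2$, when $\lambda_1\ge\lambda_2\ge0$, $\mu_1\ge\mu_2\ge0$, $\nu_1\ge\nu_2\ge\nu_3\ge0$, and $C=0$ otherwise (these are the Littlewood--Richardson coefficients associated to $SL_3$). The chamber complex is the fan in $\mathbb{R}^6$ (from Rassart's work) whose maximal cones (chambers) are the domains of polynomiality of $C$: on the integer points of each chamber $\kappa$, $C$ coincides with a polynomial $P_\kappa$, and $C$ vanishes outside the support (union of chambers). Its ray generators are $b=(2,1,2,1,3,2)$, $c=(1,1,1,1,2,1)$, $f=(1,0,1,0,1,1)$, $d_1=(1,1,1,0,1,1)$, $e_1=(1,1,0,0,1,1)$, $g_1=(1,0,0,0,1,0)$, $d_2=(1,0,1,1,1,1)$, $e_2=(0,0,1,1,1,1)$, $g_2=(0,0,1,0,1,0)$. The 18 chambers (generators; polynomial $P_\kappa$) are: $\kappa_1$: $b,c,d_1,e_2,d_2,e_1$;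 $1-\lambda_2-\mu_2+\nu_1$. $\kappa_2$: $b,c,d_1,g_1,d_2,g_2$; $1+\nu_2-\nu_3$. $\kappa_3$: $b,c,e_2,g_1,e_1,g_2$; $1+\lambda_1+\mu_1-\nu_1$. $\kappa_4$: $b,f,d_1,e_2,d_2,e_1$; $1+\nu_1-\nu_2$. $\kappa_5$: $b,f,d_1,g_1,d_2,g_2$; $1+\lambda_2+\mu_2-\nu_3$. $\kappa_6$: $b,f,e_2,g_1,e_1,g_2$; $1+\nu_3$. $\kappa_7$: $b,c,d_1,g_1,d_2,e_1$; $1+\mu_1-\nu_3$. $\kappa_8$: $b,c,d_1,e_2,d_2,g_2$; $1+\lambda_1-\nu_3$. $\kappa_9$: $b,c,d_1,e_2,e_1,g_2$; $1+\lambda_1-\lambda_2$. $\kappa_{10}$: $b,c,e_2,g_1,d_2,e_1$; $1+\mu_1-\mu_2$. $\kappa_{11}$: $b,c,d_1,g_1,e_1,g_2$; $1-\lambda_2+\nu_2$. $\kappa_{12}$: $b,c,e_2,g_1,d_2,g_2$; $1-\mu_2+\nu_2$. $\kappa_{13}$: $b,f,d_1,g_1,d_2,e_1$; $1-\lambda_1+\nu_1$. $\kappa_{14}$: $b,f,d_1,e_2,d_2,g_2$; $1-\mu_1+\nu_1$. $\kappa_{15}$: $b,f,d_1,g_1,e_1,g_2$; $1+\mu_2$. $\kappa_{16}$: $b,f,e_2,g_1,d_2,g_2$; $1+\lambda_2$. $\kappa_{17}$: $b,f,d_1,e_2,e_1,g_2$; $1+\lambda_1+\mu_2-\nu_2$.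 $\kappa_{18}$: $b,f,e_2,g_1,d_2,e_1$; $1+\lambda_2+\mu_1-\nu_2$ (here $\nu_3=\lambda_1+\lambda_2+\mu_1+\mu_2-\nu_1-\nu_2$). In particular the polynomials $P_\kappa$ are nonzero and pairwise distinct. -}

module Defs where

open import Data.Bool using (Bool; true; false; _∧_; if_then_else_; not)
open import Data.Nat as ℕ using (ℕ; zero; suc; _≤ᵇ_; _<ᵇ_; _≡ᵇ_; _∸_)
open import Data.Integer as ℤ using (ℤ; +_; ∣_∣)
open import Data.Fin using (Fin; zero; suc)
open import Data.List as L using (List; []; _∷_; map; concat; reverse; length; upTo; zip; _++_)
open import Data.Bool.ListAction using (and)
open import Data.Vec as V using (Vec; []; _∷_; lookup)
open import Data.Product using (Σ; ∃; _×_; _,_)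
open import Relation.Binary.PropositionalEquality using (_≡_)
open import Function using (_⇔_)
open import Data.Fin.Subset using (Subset)
open import Relation.Nullary using (yes; no)
import Data.Fin

-- Littlewood–Richardson coefficients, via the Littlewood–Richardson rule:
-- c^ν_{λμ} = number of LR tableaux of skew shape ν/λ and content μ,
-- i.e. fillings of ν/λ with entries in {1,…,ℓ(μ)} that are
-- semistandard (rows weakly increasing, columns strictly increasing),
-- have content μ, and whose reverse reading word (rows read right to
-- left, top to bottom) is a lattice word.
-- Partitions are lists of naturals (weakly decreasing).

allB : {A : Set} → (A → Bool) → List A → Bool
allB p xs = and (map p xs)

countB : {A : Set} → (A → Bool) → List A → ℕ
countB p []       = 0
countB p (x ∷ xs) = if p x then suc (countB p xs) else countB p xs

-- i-th entry of a list, 0 if out of range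
at : List ℕ → ℕ → ℕ
at []       _       = 0
at (x ∷ xs) zero    = x
at (x ∷ xs) (suc i) = at xs i

words : ℕ → ℕ → List (List ℕ)
words zero    k = [] ∷ []
words (suc n) k = concat (map (λ a → map (a ∷_) (words n k)) (map suc (upTo k)))

fillings : List ℕ → ℕ → List (List (List ℕ))
fillings []       k = [] ∷ []
fillings (r ∷ rs) k = concat (map (λ w → map (w ∷_) (fillings rs k)) (words r k))

weaklyIncr : List ℕ → Bool
weaklyIncr []           = true
weaklyIncr (x ∷ [])     = true
weaklyIncr (x ∷ y ∷ xs) = (x ≤ᵇ y) ∧ weaklyIncr (y ∷ xs)

occ : ℕ → List ℕ → ℕ
occ m []       = 0
occ m (x ∷ xs) = if m ≡ᵇ x then suc (occ m xs) else occ m xs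

-- columns strictly increasing between consecutive rows i and i+1
-- (row i occupies columns λ_i … ν_i - 1; entry in column j is at
-- position j ∸ λ_i of the row list)
colsOK : List ℕ → List ℕ → List (List ℕ) → Bool
colsOK λ' ν' T = and (map rowPair (upTo (length T ∸ 1)))
  where
  rowPair : ℕ → Bool
  rowPair i = allB colOK (upTo (at ν' (suc i)))
    where
    colOK : ℕ → Bool
    colOK j =
      if (at λ' (suc i) ≤ᵇ j) ∧ (at λ' i ≤ᵇ j)
      then (at (at' T i) (j ∸ at λ' i) <ᵇ at (at' T (suc i)) (j ∸ at λ' (suc i)))
      else true
      where
      at' : List (List ℕ) → ℕ → List ℕ
      at' []       _       = []
      at' (r ∷ rs) zero    = r
      at' (r ∷ rs) (suc n) = at' rs n

contentOK : ℕ → List ℕ → List (List ℕ) → Bool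
contentOK k μ T = allB (λ m → occ (suc m) (concat T) ≡ᵇ at μ m) (upTo k)

prefixes : List ℕ → List (List ℕ)
prefixes []       = [] ∷ []
prefixes (x ∷ xs) = [] ∷ map (x ∷_) (prefixes xs)

latticeWord : ℕ → List ℕ → Bool
latticeWord k w =
  allB (λ p → allB (λ m → occ (suc (suc m)) p ≤ᵇ occ (suc m) p) (upTo (k ∸ 1)))
      (prefixes w)

isLR : List ℕ → List ℕ → List ℕ → List (List ℕ) → Bool
isLR λ' μ ν' T =
  allB weaklyIncr T ∧ colsOK λ' ν' T ∧ contentOK (length μ) μ T
  ∧ latticeWord (length μ) (concat (map reverse T))

containedIn : List ℕ → List ℕ → Bool
containedIn λ' ν' = allB (λ i → at λ' i ≤ᵇ at ν' i) (upTo (length λ'))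

LR : List ℕ → List ℕ → List ℕ → ℕ
LR λ' μ ν' =
  if containedIn λ' ν'
  then countB (λ T → isLR λ' μ ν' T)
                 (fillings (map (λ i → at ν' i ∸ at λ' i) (upTo (length ν'))) (length μ))
  else 0

-- The function C : ℤ⁶ → ℤ (LR coefficients for SL₃).
-- Points of ℤ⁶ are functions Fin 6 → ℤ with coordinates
-- (λ₁, λ₂, μ₁, μ₂, ν₁, ν₂).

ℤ⁶ : Set
ℤ⁶ = Fin 6 → ℤ

C : ℤ⁶ → ℤ
C x =
  if (l2 ℤ.≤ᵇ l1) ∧ (+ 0 ℤ.≤ᵇ l2) ∧ (m2 ℤ.≤ᵇ m1) ∧ (+ 0 ℤ.≤ᵇ m2)
     ∧ (n2 ℤ.≤ᵇ n1) ∧ (n3 ℤ.≤ᵇ n2) ∧ (+ 0 ℤ.≤ᵇ n3)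
  then + LR (∣ l1 ∣ ∷ ∣ l2 ∣ ∷ []) (∣ m1 ∣ ∷ ∣ m2 ∣ ∷ []) (∣ n1 ∣ ∷ ∣ n2 ∣ ∷ ∣ n3 ∣ ∷ [])
  else + 0
  where
  l1 = x zero
  l2 = x (suc zero)
  m1 = x (suc (suc zero))
  m2 = x (suc (suc (suc zero)))
  n1 = x (suc (suc (suc (suc zero))))
  n2 = x (suc (suc (suc (suc (suc zero)))))
  n3 = l1 ℤ.+ l2 ℤ.+ m1 ℤ.+ m2 ℤ.- n1 ℤ.- n2

Mat : Set
Mat = Fin 6 → Fin 6 → ℤ

sumFin : ∀ {n} → (Fin n → ℤ) → ℤ
sumFin {zero}  f = + 0
sumFin {suc n} f = f zero ℤ.+ sumFin (λ i → f (suc i))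

applyMat : Mat → ℤ⁶ → ℤ⁶
applyMat M x i = sumFin (λ j → M i j ℤ.* x j)

_·_ : Mat → Mat → Mat
(M · N) i j = sumFin (λ k → M i k ℤ.* N k j)

idMat : Mat
idMat i j with i Data.Fin.≟ j
... | yes _ = + 1
... | no  _ = + 0

IsInverse : Mat → Mat → Set
IsInverse M N = (∀ i j → (M · N) i j ≡ idMat i j) × (∀ i j → (N · M) i j ≡ idMat i j)

vec6 : ℤ → ℤ → ℤ → ℤ → ℤ → ℤ → ℤ⁶
vec6 a b c d e f = lookup (a ∷ b ∷ c ∷ d ∷ e ∷ f ∷ [])

rb rc rf rd₁ re₁ rg₁ rd₂ re₂ rg₂ : ℤ⁶
rb  = vec6 (+ 2) (+ 1) (+ 2) (+ 1) (+ 3) (+ 2)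
rc  = vec6 (+ 1) (+ 1) (+ 1) (+ 1) (+ 2) (+ 1)
rf  = vec6 (+ 1) (+ 0) (+ 1) (+ 0) (+ 1) (+ 1)
rd₁ = vec6 (+ 1) (+ 1) (+ 1) (+ 0) (+ 1) (+ 1)
re₁ = vec6 (+ 1) (+ 1) (+ 0) (+ 0) (+ 1) (+ 1)
rg₁ = vec6 (+ 1) (+ 0) (+ 0) (+ 0) (+ 1) (+ 0)
rd₂ = vec6 (+ 1) (+ 0) (+ 1) (+ 1) (+ 1) (+ 1)
re₂ = vec6 (+ 0) (+ 0) (+ 1) (+ 1) (+ 1) (+ 1)
rg₂ = vec6 (+ 0) (+ 0) (+ 1) (+ 0) (+ 1) (+ 0)

-- ray generators of the 18 chambers κ₁ … κ₁₈ (κ_{k+1} is index k)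
chamberGens : Fin 18 → Vec ℤ⁶ 6
chamberGens k = lookup table k
  where
  table : Vec (Vec ℤ⁶ 6) 18
  table =
      (rb ∷ rc ∷ rd₁ ∷ re₂ ∷ rd₂ ∷ re₁ ∷ [])
    ∷ (rb ∷ rc ∷ rd₁ ∷ rg₁ ∷ rd₂ ∷ rg₂ ∷ [])
    ∷ (rb ∷ rc ∷ re₂ ∷ rg₁ ∷ re₁ ∷ rg₂ ∷ [])
    ∷ (rb ∷ rf ∷ rd₁ ∷ re₂ ∷ rd₂ ∷ re₁ ∷ [])
    ∷ (rb ∷ rf ∷ rd₁ ∷ rg₁ ∷ rd₂ ∷ rg₂ ∷ [])
    ∷ (rb ∷ rf ∷ re₂ ∷ rg₁ ∷ re₁ ∷ rg₂ ∷ [])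
    ∷ (rb ∷ rc ∷ rd₁ ∷ rg₁ ∷ rd₂ ∷ re₁ ∷ [])
    ∷ (rb ∷ rc ∷ rd₁ ∷ re₂ ∷ rd₂ ∷ rg₂ ∷ [])
    ∷ (rb ∷ rc ∷ rd₁ ∷ re₂ ∷ re₁ ∷ rg₂ ∷ [])
    ∷ (rb ∷ rc ∷ re₂ ∷ rg₁ ∷ rd₂ ∷ re₁ ∷ [])
    ∷ (rb ∷ rc ∷ rd₁ ∷ rg₁ ∷ re₁ ∷ rg₂ ∷ [])
    ∷ (rb ∷ rc ∷ re₂ ∷ rg₁ ∷ rd₂ ∷ rg₂ ∷ [])
    ∷ (rb ∷ rf ∷ rd₁ ∷ rg₁ ∷ rd₂ ∷ re₁ ∷ [])
    ∷ (rb ∷ rf ∷ rd₁ ∷ re₂ ∷ rd₂ ∷ rg₂ ∷ [])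
    ∷ (rb ∷ rf ∷ rd₁ ∷ rg₁ ∷ re₁ ∷ rg₂ ∷ [])
    ∷ (rb ∷ rf ∷ re₂ ∷ rg₁ ∷ rd₂ ∷ rg₂ ∷ [])
    ∷ (rb ∷ rf ∷ rd₁ ∷ re₂ ∷ re₁ ∷ rg₂ ∷ [])
    ∷ (rb ∷ rf ∷ re₂ ∷ rg₁ ∷ rd₂ ∷ re₁ ∷ [])
    ∷ []

-- Every chamber is a simplicial cone (its 6 generators form a ℤ-basis of
-- ℤ⁶), so the cells of the chamber complex are exactly the cones spanned
-- by subsets of the generators of a chamber.
Cell : Set
Cell = Fin 18 × Subset 6

-- Membership of an integer point in (the real cone of) a cell:
-- x ∈ cone(S) iff some positive multiple of x is a nonnegative integer
-- combination of the generators in S (the cones are rational, so this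
-- agrees with membership in the real cone).
_∈Cell_ : ℤ⁶ → Cell → Set
x ∈Cell (k , S) =
  Σ ℕ λ d → Σ (Fin 6 → ℕ) λ a →
    (∀ i → lookup S i ≡ false → a i ≡ 0) ×
    (∀ j → + suc d ℤ.* x j ≡ sumFin (λ i → + a i ℤ.* lookup (chamberGens k) i j))

MapsOnto : (ℤ⁶ → ℤ⁶) → Cell → Cell → Set
MapsOnto F σ τ = ∀ x → (x ∈Cell σ) ⇔ (F x ∈Cell τ)

module Submission where

open import Defs
open import Data.Bool using (Bool; true; false; T; not; _∧_; if_then_else_)
open import Data.Bool.Properties using (T-∧; T-≡)
open import Data.Empty using (⊥-elim)
open import Data.Fin using (Fin; zero; suc; _≟_; toℕ; #_)
import Data.Fin.Properties as FinP
open import Data.Fin.Permutation using (permutation)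
open import Data.Fin.Subset using (Subset)
open import Data.Integer as ℤ using (ℤ; +_; _+_; _*_; _-_; -_; ∣_∣; 0ℤ; 1ℤ; -1ℤ)
import Data.Integer.Properties as ℤP
open import Data.Integer.Tactic.RingSolver using (solve-∀)
open import Data.List using (List; []; _∷_; _++_; map; concat; reverse; replicate; upTo; length)
import Data.List.Properties as LP
open import Data.List.Membership.Propositional using (_∈_)
open import Data.List.Membership.Propositional.Properties using (∈-concat⁻′; ∈-map⁻; ∈-upTo⁺)
open import Data.List.Relation.Unary.Any using (here; there)
open import Data.List.Relation.Unary.All as All using (_∷_)
open import Data.List.Relation.Unary.All.Properties using (all⁺; map⁻)
open import Data.Nat as ℕ using (ℕ; zero; suc; _≤_; _<_; _∸_; z≤n; s≤s; _≤ᵇ_; _≡ᵇ_)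
import Data.Nat.Properties as ℕP
open import Data.Product using (Σ; ∃; ∃₂; _×_; _,_; proj₁; proj₂)
open import Data.Sum using (_⊎_; inj₁; inj₂)
open import Data.Vec using (Vec; []; _∷_; lookup; tabulate)
import Data.Vec.Properties as VecP
open import Data.Vec.Functional using (Vector)
open import Data.Vec.Relation.Unary.All using (_∷_; []) renaming (All to VecAll)
open import Data.Vec.Relation.Unary.All.Properties using (lookup⁺)
open import Function using (_∘_; mk⇔; Equivalence)
open import Relation.Nullary using (¬_; Dec; yes; no; does)
open import Relation.Nullary.Decidable using (¬?; _→-dec_)
open import Relation.Binary.PropositionalEquality
open import Algebra.Properties.Semiring.Sum ℤP.+-*-semiring using (sum; sum-cong-≗; ∑-distrib-+; ∑-comm; *-distribˡ-sum; ∑-permute)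
open import Algebra.Properties.Semiring.Sum ℕP.+-*-semiring using () renaming (sum to ∑)

decide : ∀ {A : Set} (d : Dec A) → does d ≡ true → A
decide (yes a) _ = a

sumFin≡sum : ∀ {n} (f : Vector ℤ n) → sumFin f ≡ sum f
sumFin≡sum {zero}  f = refl
sumFin≡sum {suc n} f = cong (λ t → f zero + t) (sumFin≡sum (λ i → f (suc i)))

sumFin-cong : ∀ {n} {f g : Vector ℤ n} → f ≗ g → sumFin f ≡ sumFin g
sumFin-cong {f = f} {g} f≗g = begin
  sumFin f ≡⟨ sumFin≡sum f ⟩
  sum f    ≡⟨ sum-cong-≗ {x = f} {y = g} f≗g ⟩
  sum g    ≡⟨ sumFin≡sum g ⟨
  sumFin g ∎
  where open ≡-Reasoning

sumFin-+ : ∀ {n} (f g : Vector ℤ n) → sumFin (λ i → f i + g i) ≡ sumFin f + sumFin g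
sumFin-+ f g = begin
  sumFin (λ i → f i + g i) ≡⟨ sumFin≡sum (λ i → f i + g i) ⟩
  sum (λ i → f i + g i)    ≡⟨ ∑-distrib-+ f g ⟩
  sum f + sum g            ≡⟨ cong₂ _+_ (sumFin≡sum f) (sumFin≡sum g) ⟨
  sumFin f + sumFin g      ∎
  where open ≡-Reasoning

sumFin-*ˡ : ∀ {n} c (f : Vector ℤ n) → sumFin (λ i → c * f i) ≡ c * sumFin f
sumFin-*ˡ c f = begin
  sumFin (λ i → c * f i) ≡⟨ sumFin≡sum (λ i → c * f i) ⟩
  sum (λ i → c * f i)    ≡⟨ *-distribˡ-sum c f ⟨
  c * sum f              ≡⟨ cong (c *_) (sumFin≡sum f) ⟨
  c * sumFin f           ∎
  where open ≡-Reasoning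

sumFin-*ʳ : ∀ {n} c (f : Vector ℤ n) → sumFin (λ i → f i * c) ≡ sumFin f * c
sumFin-*ʳ c f = trans (sumFin-cong (λ i → ℤP.*-comm (f i) c))
                      (trans (sumFin-*ˡ c f) (ℤP.*-comm c (sumFin f)))

sumFin-comm : ∀ {m n} (f : Fin m → Fin n → ℤ) →
              sumFin (λ i → sumFin (f i)) ≡ sumFin (λ j → sumFin (λ i → f i j))
sumFin-comm f = begin
  sumFin (λ i → sumFin (f i))            ≡⟨ sumFin-cong (λ i → sumFin≡sum (f i)) ⟩
  sumFin (λ i → sum (f i))               ≡⟨ sumFin≡sum (λ i → sum (f i)) ⟩
  sum (λ i → sum (f i))                  ≡⟨ ∑-comm f ⟩
  sum (λ j → sum (λ i → f i j))          ≡⟨ sumFin≡sum (λ j → sum (λ i → f i j)) ⟨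
  sumFin (λ j → sum (λ i → f i j))       ≡⟨ sumFin-cong (λ j → sumFin≡sum (λ i → f i j)) ⟨
  sumFin (λ j → sumFin (λ i → f i j))    ∎
  where open ≡-Reasoning

sumFin-zero : ∀ {n} {f : Vector ℤ n} → (∀ i → f i ≡ + 0) → sumFin f ≡ + 0
sumFin-zero {zero}  f≡0 = refl
sumFin-zero {suc n} f≡0 = cong₂ _+_ (f≡0 zero) (sumFin-zero (λ i → f≡0 (suc i)))

sumFin-permute : ∀ {n} (f : Vector ℤ n) (π : Fin n → Fin n) (π⁻¹ : Fin n → Fin n) →
                 (∀ i → π (π⁻¹ i) ≡ i) → (∀ i → π⁻¹ (π i) ≡ i) →
                 sumFin (λ i → f (π i)) ≡ sumFin f
sumFin-permute f π π⁻¹ ππ⁻¹ π⁻¹π = begin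
  sumFin (λ i → f (π i)) ≡⟨ sumFin≡sum (λ i → f (π i)) ⟩
  sum (λ i → f (π i))    ≡⟨ ∑-permute f (permutation π π⁻¹ ππ⁻¹ π⁻¹π) ⟨
  sum f                  ≡⟨ sumFin≡sum f ⟨
  sumFin f               ∎
  where open ≡-Reasoning

sumFin-select : ∀ {n} (c x : Vector ℤ n) i → c i ≡ + 1 → (∀ k → k ≢ i → c k ≡ + 0) →
                sumFin (λ k → c k * x k) ≡ x i
sumFin-select {suc n} c x zero c₀≡1 rest≡0 = begin
  c zero * x zero + sumFin (λ k → c (suc k) * x (suc k))
    ≡⟨ cong₂ _+_ (cong (_* x zero) c₀≡1)
                 (sumFin-zero (λ k → cong (_* x (suc k)) (rest≡0 (suc k) λ ()))) ⟩
  + 1 * x zero + + 0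
    ≡⟨ trans (ℤP.+-identityʳ _) (ℤP.*-identityˡ _) ⟩
  x zero ∎
  where open ≡-Reasoning
sumFin-select {suc n} c x (suc i) cᵢ≡1 rest≡0 = begin
  c zero * x zero + sumFin (λ k → c (suc k) * x (suc k))
    ≡⟨ cong₂ _+_ (cong (_* x zero) (rest≡0 zero λ ()))
                 (sumFin-select (λ k → c (suc k)) (λ k → x (suc k)) i cᵢ≡1
                                (λ k k≢i → rest≡0 (suc k) (k≢i ∘ FinP.suc-injective))) ⟩
  + 0 * x zero + x (suc i)
    ≡⟨ ℤP.+-identityˡ _ ⟩
  x (suc i) ∎
  where open ≡-Reasoning

dot : ∀ {n} → Vector ℤ n → Vector ℤ n → ℤ
dot u v = sumFin (λ i → u i * v i)

lincomb : ∀ {m n} → Vector ℤ m → (Fin m → Vector ℤ n) → Vector ℤ n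
lincomb c g j = sumFin (λ i → c i * g i j)

_⊖_ : ∀ {n} → Vector ℤ n → Vector ℤ n → Vector ℤ n
(u ⊖ v) i = u i - v i

0⃗ : ℤ⁶
0⃗ _ = + 0

dot-cong : ∀ {n} (h : Vector ℤ n) {x y} → x ≗ y → dot h x ≡ dot h y
dot-cong h x≗y = sumFin-cong (λ i → cong (h i *_) (x≗y i))

dot-+ : ∀ {n} (h x y : Vector ℤ n) → dot h (λ i → x i + y i) ≡ dot h x + dot h y
dot-+ h x y = trans (sumFin-cong (λ i → ℤP.*-distribˡ-+ (h i) (x i) (y i)))
                    (sumFin-+ (λ i → h i * x i) (λ i → h i * y i))

dot-* : ∀ {n} (h : Vector ℤ n) c x → dot h (λ i → c * x i) ≡ c * dot h x
dot-* h c x = trans (sumFin-cong (λ i → x*[c*y]≡c*[x*y] (h i) c (x i))) (sumFin-*ˡ c (λ i → h i * x i))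
  where
  x*[c*y]≡c*[x*y] : ∀ x c y → x * (c * y) ≡ c * (x * y)
  x*[c*y]≡c*[x*y] = solve-∀

sumFin-neg : ∀ {n} (f : Vector ℤ n) → sumFin (λ i → - f i) ≡ - sumFin f
sumFin-neg {zero}  f = refl
sumFin-neg {suc n} f = trans (cong (λ t → - f zero + t) (sumFin-neg (λ i → f (suc i))))
                             (sym (ℤP.neg-distrib-+ (f zero) (sumFin (λ i → f (suc i)))))

dot-⊖ : ∀ {n} (u v x : Vector ℤ n) → dot (u ⊖ v) x ≡ dot u x - dot v x
dot-⊖ u v x = begin
  sumFin (λ i → (u i - v i) * x i)            ≡⟨ sumFin-cong (λ i → [a-b]*c≡a*c-b*c (u i) (v i) (x i)) ⟩
  sumFin (λ i → u i * x i + - (v i * x i))    ≡⟨ sumFin-+ (λ i → u i * x i) (λ i → - (v i * x i)) ⟩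
  dot u x + sumFin (λ i → - (v i * x i))      ≡⟨ cong (λ t → dot u x + t) (sumFin-neg (λ i → v i * x i)) ⟩
  dot u x - dot v x                           ∎
  where
  open ≡-Reasoning
  [a-b]*c≡a*c-b*c : ∀ a b c → (a - b) * c ≡ a * c - b * c
  [a-b]*c≡a*c-b*c = solve-∀

dot-lincomb : ∀ {m n} (h : Vector ℤ n) (c : Vector ℤ m) (g : Fin m → Vector ℤ n) →
              dot h (lincomb c g) ≡ sumFin (λ i → c i * dot h (g i))
dot-lincomb h c g = begin
  sumFin (λ j → h j * sumFin (λ i → c i * g i j))   ≡⟨ sumFin-cong (λ j → sumFin-*ˡ (h j) (λ i → c i * g i j)) ⟨
  sumFin (λ j → sumFin (λ i → h j * (c i * g i j))) ≡⟨ sumFin-comm (λ j i → h j * (c i * g i j)) ⟩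
  sumFin (λ i → sumFin (λ j → h j * (c i * g i j))) ≡⟨ sumFin-cong (λ i → dot-* h (c i) (g i)) ⟩
  sumFin (λ i → c i * dot h (g i))                  ∎
  where open ≡-Reasoning

applyMat-cong : ∀ A {x y} → x ≗ y → applyMat A x ≗ applyMat A y
applyMat-cong A x≗y i = dot-cong (A i) x≗y

applyMat-+ : ∀ A x y → applyMat A (λ i → x i + y i) ≗ λ i → applyMat A x i + applyMat A y i
applyMat-+ A x y i = dot-+ (A i) x y

applyMat-* : ∀ A c x → applyMat A (λ i → c * x i) ≗ λ i → c * applyMat A x i
applyMat-* A c x i = dot-* (A i) c x

applyMat-lincomb : ∀ {m} A (c : Vector ℤ m) (g : Fin m → ℤ⁶) →
                   applyMat A (lincomb c g) ≗ lincomb c (λ i → applyMat A (g i))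
applyMat-lincomb A c g i = dot-lincomb (A i) c g

applyMat-zero : ∀ A → applyMat A 0⃗ ≗ 0⃗
applyMat-zero A i = sumFin-zero (λ j → ℤP.*-zeroʳ (A i j))

idMat-diag : ∀ i → idMat i i ≡ + 1
idMat-diag i with i ≟ i
... | yes _  = refl
... | no i≢i = ⊥-elim (i≢i refl)

idMat-offdiag : ∀ {i j} → i ≢ j → idMat i j ≡ + 0
idMat-offdiag {i} {j} i≢j with i ≟ j
... | yes i≡j = ⊥-elim (i≢j i≡j)
... | no _    = refl

sumFin-idMatˡ : ∀ (x : ℤ⁶) i → sumFin (λ k → idMat i k * x k) ≡ x i
sumFin-idMatˡ x i = sumFin-select (idMat i) x i (idMat-diag i) (λ k k≢i → idMat-offdiag (k≢i ∘ sym))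

sumFin-idMatʳ : ∀ (x : ℤ⁶) i → sumFin (λ k → idMat k i * x k) ≡ x i
sumFin-idMatʳ x i = sumFin-select (λ k → idMat k i) x i (idMat-diag i) (λ k → idMat-offdiag)

applyMat-inverse : ∀ A B → (∀ i j → (A · B) i j ≡ idMat i j) → ∀ x → applyMat A (applyMat B x) ≗ x
applyMat-inverse A B AB≡I x i = begin
  sumFin (λ j → A i j * sumFin (λ k → B j k * x k))   ≡⟨ sumFin-cong (λ j → sumFin-*ˡ (A i j) (λ k → B j k * x k)) ⟨
  sumFin (λ j → sumFin (λ k → A i j * (B j k * x k))) ≡⟨ sumFin-comm (λ j k → A i j * (B j k * x k)) ⟩
  sumFin (λ k → sumFin (λ j → A i j * (B j k * x k))) ≡⟨ sumFin-cong column ⟩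
  sumFin (λ k → idMat i k * x k)                      ≡⟨ sumFin-idMatˡ x i ⟩
  x i                                                 ∎
  where
  open ≡-Reasoning
  column : ∀ k → sumFin (λ j → A i j * (B j k * x k)) ≡ idMat i k * x k
  column k = begin
    sumFin (λ j → A i j * (B j k * x k)) ≡⟨ sumFin-cong (λ j → ℤP.*-assoc (A i j) (B j k) (x k)) ⟨
    sumFin (λ j → A i j * B j k * x k)   ≡⟨ sumFin-*ʳ (x k) (λ j → A i j * B j k) ⟩
    (A · B) i k * x k                    ≡⟨ cong (_* x k) (AB≡I i k) ⟩
    idMat i k * x k                      ∎

lincomb-dualBasis : (F G : Fin 6 → ℤ⁶) → (∀ a j → sumFin (λ i → F i a * G i j) ≡ idMat a j) →
                    ∀ x → lincomb (λ i → dot (F i) x) G ≗ x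
lincomb-dualBasis F G FG≡I x j = begin
  sumFin (λ i → sumFin (λ a → F i a * x a) * G i j)   ≡⟨ sumFin-cong (λ i → sumFin-*ʳ (G i j) (λ a → F i a * x a)) ⟨
  sumFin (λ i → sumFin (λ a → F i a * x a * G i j))   ≡⟨ sumFin-comm (λ i a → F i a * x a * G i j) ⟩
  sumFin (λ a → sumFin (λ i → F i a * x a * G i j))   ≡⟨ sumFin-cong row ⟩
  sumFin (λ a → idMat a j * x a)                      ≡⟨ sumFin-idMatʳ x j ⟩
  x j                                                 ∎
  where
  open ≡-Reasoning
  row : ∀ a → sumFin (λ i → F i a * x a * G i j) ≡ idMat a j * x a
  row a = begin
    sumFin (λ i → F i a * x a * G i j) ≡⟨ sumFin-cong (λ i → x*y*z≡x*z*y (F i a) (x a) (G i j)) ⟩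
    sumFin (λ i → F i a * G i j * x a) ≡⟨ sumFin-*ʳ (x a) (λ i → F i a * G i j) ⟩
    sumFin (λ i → F i a * G i j) * x a ≡⟨ cong (_* x a) (FG≡I a j) ⟩
    idMat a j * x a                    ∎
    where
    x*y*z≡x*z*y : ∀ x y z → x * y * z ≡ x * z * y
    x*y*z≡x*z*y = solve-∀

-- Two-row Littlewood–Richardson tableaux

private
  T-∧⁻ : ∀ {a b} → T (a ∧ b) → T a × T b
  T-∧⁻ = Equivalence.to T-∧

row : ℕ → ℕ → List ℕ
row p q = replicate p 1 ++ replicate q 2

weaklyIncr-tail : ∀ x w → T (weaklyIncr (x ∷ w)) → T (weaklyIncr w)
weaklyIncr-tail x []      _ = _
weaklyIncr-tail x (y ∷ w) h = proj₂ (T-∧⁻ {x ≤ᵇ y} h)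

weaklyIncr-word⇒row : ∀ n w → w ∈ words n 2 → T (weaklyIncr w) →
                      ∃₂ λ p q → p ℕ.+ q ≡ n × w ≡ row p q
weaklyIncr-word⇒row zero    w (here refl) _ = 0 , 0 , refl , refl
weaklyIncr-word⇒row (suc n) w w∈ incr
  with ∈-concat⁻′ (map (λ a → map (a ∷_) (words n 2)) (1 ∷ 2 ∷ [])) w∈
... | _ , w∈xs , here refl
  with w′ , w′∈ , refl ← ∈-map⁻ _ w∈xs
  with p , q , p+q≡n , refl ← weaklyIncr-word⇒row n w′ w′∈ (weaklyIncr-tail 1 w′ incr)
  = suc p , q , cong suc p+q≡n , refl
... | _ , w∈xs , there (here refl)
  with w′ , w′∈ , refl ← ∈-map⁻ _ w∈xs
  with weaklyIncr-word⇒row n w′ w′∈ (weaklyIncr-tail 2 w′ incr)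
... | zero , q , q≡n , refl = 0 , suc q , cong suc q≡n , refl
... | suc p , q , _ , refl = ⊥-elim incr

at-row-ones : ∀ p q k → k < p → at (row p q) k ≡ 1
at-row-ones (suc p) q zero    _         = refl
at-row-ones (suc p) q (suc k) (s≤s k<p) = at-row-ones p q k k<p

at-row-twos : ∀ p q k → p ≤ k → k < p ℕ.+ q → at (row p q) k ≡ 2
at-row-twos zero    (suc q) zero    _          _         = refl
at-row-twos zero    (suc q) (suc k) _          (s≤s k<q) = at-row-twos 0 q k z≤n k<q
at-row-twos (suc p) q       (suc k) (s≤s p≤k)  (s≤s k<n) = at-row-twos p q k p≤k k<n

at-row-≤2 : ∀ p q k → at (row p q) k ≤ 2
at-row-≤2 zero    zero    k       = z≤n
at-row-≤2 zero    (suc q) zero    = ℕP.≤-refl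
at-row-≤2 zero    (suc q) (suc k) = at-row-≤2 0 q k
at-row-≤2 (suc p) q       zero    = s≤s z≤n
at-row-≤2 (suc p) q       (suc k) = at-row-≤2 p q k

at-row-≥1 : ∀ p q k → k < p ℕ.+ q → 1 ≤ at (row p q) k
at-row-≥1 p q k k<p+q with k ℕP.<? p
... | yes k<p = ℕP.≤-reflexive (sym (at-row-ones p q k k<p))
... | no  k≮p = ℕP.≤-trans (s≤s z≤n) (ℕP.≤-reflexive (sym (at-row-twos p q k (ℕP.≮⇒≥ k≮p) k<p+q)))

occ-++ : ∀ m u v → occ m (u ++ v) ≡ occ m u ℕ.+ occ m v
occ-++ m []      v = refl
occ-++ m (x ∷ u) v with m ≡ᵇ x
... | true  = cong suc (occ-++ m u v)
... | false = occ-++ m u v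

occ₁-row : ∀ p q → occ 1 (row p q) ≡ p
occ₁-row zero    zero    = refl
occ₁-row zero    (suc q) = occ₁-row zero q
occ₁-row (suc p) q       = cong suc (occ₁-row p q)

occ₂-row : ∀ p q → occ 2 (row p q) ≡ q
occ₂-row zero    zero    = refl
occ₂-row zero    (suc q) = cong suc (occ₂-row zero q)
occ₂-row (suc p) q       = occ₂-row p q

Balanced : ℕ → List ℕ → Set
Balanced d w = All.All (λ u → occ 2 u ≤ d ℕ.+ occ 1 u) (prefixes w)

latticeWord⇒balanced : ∀ w → T (latticeWord 2 w) → Balanced 0 w
latticeWord⇒balanced w h =
  All.map (λ hu → ℕP.≤ᵇ⇒≤ _ _ (proj₁ (T-∧⁻ hu))) (all⁺ _ (prefixes w) h)

balanced-∷1 : ∀ {d w} → Balanced d (1 ∷ w) → Balanced (suc d) w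
balanced-∷1 {d} (_ ∷ h) = All.map (λ {u} le → subst (occ 2 u ≤_) (ℕP.+-suc d (occ 1 u)) le) (map⁻ h)

balanced-∷2 : ∀ {d w} → Balanced d (2 ∷ w) → ∃ λ d′ → d ≡ suc d′ × Balanced d′ w
balanced-∷2 {zero} {[]}    (_ ∷ () ∷ _)
balanced-∷2 {zero} {_ ∷ _} (_ ∷ () ∷ _)
balanced-∷2 {suc d}        (_ ∷ h)      = d , refl , All.map (λ { (s≤s le) → le }) (map⁻ h)

balanced-ones : ∀ {d w} p → Balanced d (replicate p 1 ++ w) → Balanced (p ℕ.+ d) w
balanced-ones         zero    h = h
balanced-ones {d} {w} (suc p) h =
  subst (λ e → Balanced e w) (ℕP.+-suc p d) (balanced-ones p (balanced-∷1 h))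

balanced-twos : ∀ {d w} q → Balanced d (replicate q 2 ++ w) → ∃ λ d′ → d ≡ q ℕ.+ d′ × Balanced d′ w
balanced-twos zero    h = _ , refl , h
balanced-twos (suc q) h with _ , refl , h₁ ← balanced-∷2 h with _ , refl , h₂ ← balanced-twos q h₁
  = _ , refl , h₂

reverse-replicate : ∀ n (a : ℕ) → reverse (replicate n a) ≡ replicate n a
reverse-replicate zero    a = refl
reverse-replicate (suc n) a = begin
  reverse (a ∷ replicate n a)   ≡⟨ LP.unfold-reverse a (replicate n a) ⟩
  reverse (replicate n a) ++ [a] ≡⟨ cong (_++ [a]) (reverse-replicate n a) ⟩
  replicate n a ++ [a]           ≡⟨ snoc n ⟩
  a ∷ replicate n a              ∎
  where
  open ≡-Reasoning
  [a] = a ∷ []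
  snoc : ∀ n → replicate n a ++ [a] ≡ a ∷ replicate n a
  snoc zero    = refl
  snoc (suc n) = cong (a ∷_) (snoc n)

reverse-row : ∀ p q → reverse (row p q) ≡ replicate q 2 ++ replicate p 1
reverse-row p q = trans (LP.reverse-++ (replicate p 1) (replicate q 2))
                        (cong₂ _++_ (reverse-replicate q 2) (reverse-replicate p 1))

balanced-reversed-row : ∀ {d} p q w → Balanced d (reverse (row p q) ++ w) →
                        ∃ λ d′ → d ≡ q ℕ.+ d′ × Balanced (p ℕ.+ d′) w
balanced-reversed-row p q w h
  with d′ , d≡ , h′ ← balanced-twos q (subst (Balanced _) (LP.++-assoc (replicate q 2) (replicate p 1) w)
                                        (subst (λ r → Balanced _ (r ++ w)) (reverse-row p q) h))
  = d′ , d≡ , balanced-ones p h′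

lattice-rows : ∀ p₁ q₁ p₂ q₂ p₃ q₃ →
               Balanced 0 (concat (map reverse (row p₁ q₁ ∷ row p₂ q₂ ∷ row p₃ q₃ ∷ []))) →
               q₁ ≡ 0 × q₂ ≤ p₁ × q₂ ℕ.+ q₃ ≤ p₁ ℕ.+ p₂
lattice-rows p₁ q₁ p₂ q₂ p₃ q₃ h
  with d₁ , 0≡q₁+d₁ , h₁ ← balanced-reversed-row p₁ q₁ _ h
  with d₂ , p₁+d₁≡q₂+d₂ , h₂ ← balanced-reversed-row p₂ q₂ _ h₁
  with d₃ , p₂+d₂≡q₃+d₃ , _ ← balanced-reversed-row p₃ q₃ _ h₂
  with refl ← ℕP.m+n≡0⇒m≡0 q₁ (sym 0≡q₁+d₁) | refl ← ℕP.m+n≡0⇒n≡0 q₁ (sym 0≡q₁+d₁)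
  = refl , q₂≤p₁ , q₂+q₃≤p₁+p₂
  where
  open ℕP.≤-Reasoning
  q₂≤p₁ : q₂ ≤ p₁
  q₂≤p₁ = begin
    q₂      ≤⟨ ℕP.m≤m+n q₂ d₂ ⟩
    q₂ ℕ.+ d₂ ≡⟨ p₁+d₁≡q₂+d₂ ⟨
    p₁ ℕ.+ 0  ≡⟨ ℕP.+-identityʳ p₁ ⟩
    p₁      ∎
  q₂+q₃≤p₁+p₂ : q₂ ℕ.+ q₃ ≤ p₁ ℕ.+ p₂
  q₂+q₃≤p₁+p₂ = begin
    q₂ ℕ.+ q₃         ≤⟨ ℕP.+-monoʳ-≤ q₂ (ℕP.m≤m+n q₃ d₃) ⟩
    q₂ ℕ.+ (q₃ ℕ.+ d₃)  ≡⟨ cong (q₂ ℕ.+_) (sym p₂+d₂≡q₃+d₃) ⟩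
    q₂ ℕ.+ (p₂ ℕ.+ d₂)  ≡⟨ ℕP.+-comm q₂ (p₂ ℕ.+ d₂) ⟩
    p₂ ℕ.+ d₂ ℕ.+ q₂    ≡⟨ ℕP.+-assoc p₂ d₂ q₂ ⟩
    p₂ ℕ.+ (d₂ ℕ.+ q₂)  ≡⟨ cong (p₂ ℕ.+_) (trans (ℕP.+-comm d₂ q₂) (sym p₁+d₁≡q₂+d₂)) ⟩
    p₂ ℕ.+ (p₁ ℕ.+ 0)   ≡⟨ cong (p₂ ℕ.+_) (ℕP.+-identityʳ p₁) ⟩
    p₂ ℕ.+ p₁         ≡⟨ ℕP.+-comm p₂ p₁ ⟩
    p₁ ℕ.+ p₂         ∎

occ-rows : ∀ m r₁ r₂ r₃ → occ m (concat (r₁ ∷ r₂ ∷ r₃ ∷ [])) ≡ occ m r₁ ℕ.+ (occ m r₂ ℕ.+ occ m r₃)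
occ-rows m r₁ r₂ r₃ =
  trans (occ-++ m r₁ _) (cong (occ m r₁ ℕ.+_) (trans (occ-++ m r₂ _)
        (cong (occ m r₂ ℕ.+_) (trans (occ-++ m r₃ []) (ℕP.+-identityʳ _)))))

content-rows : ∀ M₁ M₂ p₁ q₁ p₂ q₂ p₃ q₃ →
               T (contentOK 2 (M₁ ∷ M₂ ∷ []) (row p₁ q₁ ∷ row p₂ q₂ ∷ row p₃ q₃ ∷ [])) →
               M₁ ≡ p₁ ℕ.+ (p₂ ℕ.+ p₃) × M₂ ≡ q₁ ℕ.+ (q₂ ℕ.+ q₃)
content-rows M₁ M₂ p₁ q₁ p₂ q₂ p₃ q₃ h with c₁ , c₂ ← T-∧⁻ h =
  trans (sym (ℕP.≡ᵇ⇒≡ _ _ c₁)) (trans (occ-rows 1 (row p₁ q₁) (row p₂ q₂) (row p₃ q₃))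
        (cong₂ ℕ._+_ (occ₁-row p₁ q₁) (cong₂ ℕ._+_ (occ₁-row p₂ q₂) (occ₁-row p₃ q₃)))) ,
  trans (sym (ℕP.≡ᵇ⇒≡ _ _ (proj₁ (T-∧⁻ c₂)))) (trans (occ-rows 2 (row p₁ q₁) (row p₂ q₂) (row p₃ q₃))
        (cong₂ ℕ._+_ (occ₂-row p₁ q₁) (cong₂ ℕ._+_ (occ₂-row p₂ q₂) (occ₂-row p₃ q₃))))

private
  T-if : ∀ {b c} → T b → T (if b then c else true) → T c
  T-if {true} _ h = h

  column : ∀ {P : ℕ → Bool} n j → j < n → T (allB P (upTo n)) → T (P j)
  column n j j<n h = All.lookup (all⁺ _ (upTo n) h) (∈-upTo⁺ j<n)

columns-strict : ∀ L₁ L₂ N₁ N₂ N₃ r₁ r₂ r₃ →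
                 T (colsOK (L₁ ∷ L₂ ∷ []) (N₁ ∷ N₂ ∷ N₃ ∷ []) (r₁ ∷ r₂ ∷ r₃ ∷ [])) →
                 (∀ j → j < N₂ → L₂ ≤ j → L₁ ≤ j → at r₁ (j ∸ L₁) < at r₂ (j ∸ L₂)) ×
                 (∀ j → j < N₃ → L₂ ≤ j → at r₂ (j ∸ L₂) < at r₃ j)
columns-strict L₁ L₂ N₁ N₂ N₃ r₁ r₂ r₃ h with rows₁₂ , rest ← T-∧⁻ h =
  (λ j j<N₂ L₂≤j L₁≤j → ℕP.<ᵇ⇒< _ _
     (T-if (Equivalence.from T-∧ (ℕP.≤⇒≤ᵇ L₂≤j , ℕP.≤⇒≤ᵇ L₁≤j)) (column N₂ j j<N₂ rows₁₂))) ,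
  (λ j j<N₃ L₂≤j → ℕP.<ᵇ⇒< _ _
     (T-if (ℕP.≤⇒≤ᵇ L₂≤j) (column N₃ j j<N₃ (proj₁ (T-∧⁻ rest)))))

private
  ∸-<-+ : ∀ {m j p} → m ≤ j → j < m ℕ.+ p → j ∸ m < p
  ∸-<-+ {m} {j} {p} m≤j j<m+p = subst (j ∸ m <_) (ℕP.m+n∸m≡n m p) (ℕP.∸-monoˡ-< j<m+p m≤j)

  first-entry-≥1 : ∀ {L p q} → 0 < p ℕ.+ q → 1 ≤ at (row p q) (L ∸ L)
  first-entry-≥1 {L} {p} {q} 0<p+q =
    subst (λ k → 1 ≤ at (row p q) k) (sym (ℕP.n∸n≡0 L)) (at-row-≥1 p q 0 0<p+q)

columns⇒L₂+p₂≤L₁ : ∀ {L₁ L₂ N₂} p₁ q₁ p₂ q₂ →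
  (∀ j → j < N₂ → L₂ ≤ j → L₁ ≤ j → at (row p₁ q₁) (j ∸ L₁) < at (row p₂ q₂) (j ∸ L₂)) →
  L₂ ≤ L₁ → L₂ ℕ.+ p₂ ≤ N₂ → (L₁ < N₂ → 0 < p₁ ℕ.+ q₁) → L₂ ℕ.+ p₂ ≤ L₁
columns⇒L₂+p₂≤L₁ {L₁} {L₂} {N₂} p₁ q₁ p₂ q₂ strict L₂≤L₁ L₂+p₂≤N₂ row₁-long
  with L₂ ℕ.+ p₂ ℕP.≤? L₁
... | yes le = le
... | no  gt = ⊥-elim (ℕP.<⇒≱ entries (first-entry-≥1 {L₁} {p₁} {q₁} (row₁-long L₁<N₂)))
  where
  L₁<L₂+p₂ = ℕP.≰⇒> gt
  L₁<N₂    = ℕP.<-≤-trans L₁<L₂+p₂ L₂+p₂≤N₂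
  entries : at (row p₁ q₁) (L₁ ∸ L₁) < 1
  entries = subst (at (row p₁ q₁) (L₁ ∸ L₁) <_) (at-row-ones p₂ q₂ _ (∸-<-+ L₂≤L₁ L₁<L₂+p₂))
                  (strict L₁ L₁<N₂ L₂≤L₁ ℕP.≤-refl)

columns⇒p₃≤L₂ : ∀ {L₂ N₃} p₂ q₂ p₃ q₃ →
  (∀ j → j < N₃ → L₂ ≤ j → at (row p₂ q₂) (j ∸ L₂) < at (row p₃ q₃) j) →
  p₃ ≤ N₃ → (L₂ < N₃ → 0 < p₂ ℕ.+ q₂) → p₃ ≤ L₂
columns⇒p₃≤L₂ {L₂} {N₃} p₂ q₂ p₃ q₃ strict p₃≤N₃ row₂-long
  with p₃ ℕP.≤? L₂
... | yes le = le
... | no  gt = ⊥-elim (ℕP.<⇒≱ entries (first-entry-≥1 {L₂} {p₂} {q₂} (row₂-long L₂<N₃)))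
  where
  L₂<p₃ = ℕP.≰⇒> gt
  L₂<N₃ = ℕP.<-≤-trans L₂<p₃ p₃≤N₃
  entries : at (row p₂ q₂) (L₂ ∸ L₂) < 1
  entries = subst (at (row p₂ q₂) (L₂ ∸ L₂) <_) (at-row-ones p₃ q₃ L₂ L₂<p₃)
                  (strict L₂ L₂<N₃ ℕP.≤-refl)

columns⇒p₃+q₃≤L₂+p₂ : ∀ {L₂ N₃} p₂ q₂ p₃ q₃ →
  (∀ j → j < N₃ → L₂ ≤ j → at (row p₂ q₂) (j ∸ L₂) < at (row p₃ q₃) j) →
  N₃ ≡ p₃ ℕ.+ q₃ → N₃ ≤ L₂ ℕ.+ (p₂ ℕ.+ q₂) → p₃ ℕ.+ q₃ ≤ L₂ ℕ.+ p₂
columns⇒p₃+q₃≤L₂+p₂ {L₂} {N₃} p₂ q₂ p₃ q₃ strict N₃≡ N₃≤N₂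
  with p₃ ℕ.+ q₃ ℕP.≤? L₂ ℕ.+ p₂
... | yes le = le
... | no  gt = ⊥-elim (ℕP.<⇒≱ entries (at-row-≤2 p₃ q₃ (L₂ ℕ.+ p₂)))
  where
  j<N₃ : L₂ ℕ.+ p₂ < N₃
  j<N₃ = subst (L₂ ℕ.+ p₂ <_) (sym N₃≡) (ℕP.≰⇒> gt)
  p₂<p₂+q₂ : p₂ < p₂ ℕ.+ q₂
  p₂<p₂+q₂ = ℕP.+-cancelˡ-< L₂ p₂ (p₂ ℕ.+ q₂) (ℕP.<-≤-trans j<N₃ N₃≤N₂)
  entry₂ : at (row p₂ q₂) (L₂ ℕ.+ p₂ ∸ L₂) ≡ 2
  entry₂ = subst (λ k → at (row p₂ q₂) k ≡ 2) (sym (ℕP.m+n∸m≡n L₂ p₂))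
                 (at-row-twos p₂ q₂ p₂ ℕP.≤-refl p₂<p₂+q₂)
  entries : 2 < at (row p₃ q₃) (L₂ ℕ.+ p₂)
  entries = subst (_< at (row p₃ q₃) (L₂ ℕ.+ p₂)) entry₂ (strict (L₂ ℕ.+ p₂) j<N₃ (ℕP.m≤m+n L₂ p₂))

-- Row r of the tableau is 1^{p_r} 2^{q_r}; the lattice condition forces q₁ = 0.
record LRTableau (L₁ L₂ M₁ M₂ N₁ N₂ : ℕ) : Set where
  field
    p₁ p₂ p₃ q₂ q₃ : ℕ
    N₁≡ : N₁ ≡ L₁ ℕ.+ p₁
    N₂≡ : N₂ ≡ L₂ ℕ.+ p₂ ℕ.+ q₂
    M₁≡ : M₁ ≡ p₁ ℕ.+ p₂ ℕ.+ p₃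
    M₂≡ : M₂ ≡ q₂ ℕ.+ q₃
    L₂+p₂≤L₁    : L₂ ℕ.+ p₂ ≤ L₁
    p₃≤L₂       : p₃ ≤ L₂
    p₃+q₃≤L₂+p₂ : p₃ ℕ.+ q₃ ≤ L₂ ℕ.+ p₂
    q₂≤p₁       : q₂ ≤ p₁
    q₂+q₃≤p₁+p₂ : q₂ ℕ.+ q₃ ≤ p₁ ℕ.+ p₂

tableau-of-rows : ∀ {L₁ L₂ M₁ M₂ N₁ N₂ N₃} p₁ q₁ p₂ q₂ p₃ q₃ →
  L₂ ≤ L₁ → N₂ ≤ N₁ → N₃ ≤ N₂ → L₁ ≤ N₁ → L₂ ≤ N₂ →
  p₁ ℕ.+ q₁ ≡ N₁ ∸ L₁ → p₂ ℕ.+ q₂ ≡ N₂ ∸ L₂ → p₃ ℕ.+ q₃ ≡ N₃ →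
  T (colsOK (L₁ ∷ L₂ ∷ []) (N₁ ∷ N₂ ∷ N₃ ∷ []) (row p₁ q₁ ∷ row p₂ q₂ ∷ row p₃ q₃ ∷ [])) →
  T (contentOK 2 (M₁ ∷ M₂ ∷ []) (row p₁ q₁ ∷ row p₂ q₂ ∷ row p₃ q₃ ∷ [])) →
  T (latticeWord 2 (concat (map reverse (row p₁ q₁ ∷ row p₂ q₂ ∷ row p₃ q₃ ∷ [])))) →
  LRTableau L₁ L₂ M₁ M₂ N₁ N₂
tableau-of-rows {L₁} {L₂} {M₁} {M₂} {N₁} {N₂} {N₃} p₁ q₁ p₂ q₂ p₃ q₃
                L₂≤L₁ N₂≤N₁ N₃≤N₂ L₁≤N₁ L₂≤N₂ len₁ len₂ len₃ cols content lattice
  with refl , q₂≤p₁ , q₂+q₃≤p₁+p₂ ← lattice-rows p₁ q₁ p₂ q₂ p₃ q₃ (latticeWord⇒balanced _ lattice)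
  with M₁≡ , M₂≡ ← content-rows M₁ M₂ p₁ 0 p₂ q₂ p₃ q₃ content
  with strict₁₂ , strict₂₃ ← columns-strict L₁ L₂ N₁ N₂ N₃ (row p₁ 0) (row p₂ q₂) (row p₃ q₃) cols
  = record
      { p₁ = p₁ ; p₂ = p₂ ; p₃ = p₃ ; q₂ = q₂ ; q₃ = q₃
      ; N₁≡ = trans (sym N₁≡L₁+p₁+0) (cong (L₁ ℕ.+_) (ℕP.+-identityʳ p₁))
      ; N₂≡ = trans (sym N₂≡L₂+p₂+q₂) (sym (ℕP.+-assoc L₂ p₂ q₂))
      ; M₁≡ = trans M₁≡ (sym (ℕP.+-assoc p₁ p₂ p₃))
      ; M₂≡ = M₂≡
      ; L₂+p₂≤L₁ = columns⇒L₂+p₂≤L₁ p₁ 0 p₂ q₂ strict₁₂ L₂≤L₁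
                     (subst (L₂ ℕ.+ p₂ ≤_) N₂≡L₂+p₂+q₂ (ℕP.≤-trans (ℕP.m≤m+n (L₂ ℕ.+ p₂) q₂)
                                                     (ℕP.≤-reflexive (ℕP.+-assoc L₂ p₂ q₂))))
                     (λ L₁<N₂ → subst (0 <_) (sym len₁) (ℕP.m<n⇒0<n∸m (ℕP.<-≤-trans L₁<N₂ N₂≤N₁)))
      ; p₃≤L₂ = columns⇒p₃≤L₂ p₂ q₂ p₃ q₃ strict₂₃ (subst (p₃ ≤_) len₃ (ℕP.m≤m+n p₃ q₃))
                  (λ L₂<N₃ → subst (0 <_) (sym len₂) (ℕP.m<n⇒0<n∸m (ℕP.<-≤-trans L₂<N₃ N₃≤N₂)))
      ; p₃+q₃≤L₂+p₂ = columns⇒p₃+q₃≤L₂+p₂ p₂ q₂ p₃ q₃ strict₂₃ (sym len₃)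
                        (subst (N₃ ≤_) (sym N₂≡L₂+p₂+q₂) N₃≤N₂)
      ; q₂≤p₁ = q₂≤p₁
      ; q₂+q₃≤p₁+p₂ = q₂+q₃≤p₁+p₂
      }
  where
  N₁≡L₁+p₁+0 : L₁ ℕ.+ (p₁ ℕ.+ 0) ≡ N₁
  N₁≡L₁+p₁+0 = trans (cong (L₁ ℕ.+_) len₁) (ℕP.m+[n∸m]≡n L₁≤N₁)
  N₂≡L₂+p₂+q₂ : L₂ ℕ.+ (p₂ ℕ.+ q₂) ≡ N₂
  N₂≡L₂+p₂+q₂ = trans (cong (L₂ ℕ.+_) len₂) (ℕP.m+[n∸m]≡n L₂≤N₂)

countB-nonzero : ∀ {A : Set} (p : A → Bool) xs → countB p xs ≢ 0 → ∃ λ x → x ∈ xs × T (p x)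
countB-nonzero p []       c≢0 = ⊥-elim (c≢0 refl)
countB-nonzero p (x ∷ xs) c≢0 with p x in px
... | true  = x , here refl , subst T (sym px) _
... | false with y , y∈ , py ← countB-nonzero p xs c≢0 = y , there y∈ , py

fillings-∷ : ∀ {r rs k T′} → T′ ∈ fillings (r ∷ rs) k →
             ∃₂ λ w T″ → T′ ≡ w ∷ T″ × w ∈ words r k × T″ ∈ fillings rs k
fillings-∷ {r} {rs} {k} T′∈
  with _ , T′∈xs , xs∈ ← ∈-concat⁻′ (map (λ w → map (w ∷_) (fillings rs k)) (words r k)) T′∈
  with w , w∈ , refl ← ∈-map⁻ _ xs∈
  with T″ , T″∈ , refl ← ∈-map⁻ _ T′∈xs
  = w , T″ , refl , w∈ , T″∈

isLR-parts : ∀ λ′ μ ν′ T′ → T (isLR λ′ μ ν′ T′) →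
             T (allB weaklyIncr T′) × T (colsOK λ′ ν′ T′) ×
             T (contentOK (length μ) μ T′) × T (latticeWord (length μ) (concat (map reverse T′)))
isLR-parts λ′ μ ν′ T′ h
  with incr , rest₁ ← T-∧⁻ {allB weaklyIncr T′} h
  with cols , rest₂ ← T-∧⁻ {colsOK λ′ ν′ T′} rest₁
  = incr , cols , T-∧⁻ {contentOK (length μ) μ T′} rest₂

LR-nonzero⇒tableau : ∀ L₁ L₂ M₁ M₂ N₁ N₂ N₃ → L₂ ≤ L₁ → N₂ ≤ N₁ → N₃ ≤ N₂ →
                     LR (L₁ ∷ L₂ ∷ []) (M₁ ∷ M₂ ∷ []) (N₁ ∷ N₂ ∷ N₃ ∷ []) ≢ 0 →
                     LRTableau L₁ L₂ M₁ M₂ N₁ N₂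
LR-nonzero⇒tableau L₁ L₂ M₁ M₂ N₁ N₂ N₃ L₂≤L₁ N₂≤N₁ N₃≤N₂ LR≢0
  with containedIn (L₁ ∷ L₂ ∷ []) (N₁ ∷ N₂ ∷ N₃ ∷ []) in contained
... | false = ⊥-elim (LR≢0 refl)
... | true
  with T′ , T′∈ , isLR-T′ ← countB-nonzero (isLR (L₁ ∷ L₂ ∷ []) (M₁ ∷ M₂ ∷ []) (N₁ ∷ N₂ ∷ N₃ ∷ []))
                                          (fillings (N₁ ∸ L₁ ∷ N₂ ∸ L₂ ∷ N₃ ∷ []) 2) LR≢0
  with w₁ , _ , refl , w₁∈ , T₁∈ ← fillings-∷ {N₁ ∸ L₁} {N₂ ∸ L₂ ∷ N₃ ∷ []} {2} T′∈
  with w₂ , _ , refl , w₂∈ , T₂∈ ← fillings-∷ {N₂ ∸ L₂} {N₃ ∷ []} {2} T₁∈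
  with w₃ , _ , refl , w₃∈ , here refl ← fillings-∷ {N₃} {[]} {2} T₂∈
  with incr , cols , content , lattice ← isLR-parts (L₁ ∷ L₂ ∷ []) (M₁ ∷ M₂ ∷ []) (N₁ ∷ N₂ ∷ N₃ ∷ [])
                                                    (w₁ ∷ w₂ ∷ w₃ ∷ []) isLR-T′
  with incr₁ , incr₂₃ ← T-∧⁻ incr
  with incr₂ , incr₃ ← T-∧⁻ incr₂₃
  with p₁ , q₁ , len₁ , refl ← weaklyIncr-word⇒row _ w₁ w₁∈ incr₁
  with p₂ , q₂ , len₂ , refl ← weaklyIncr-word⇒row _ w₂ w₂∈ incr₂
  with p₃ , q₃ , len₃ , refl ← weaklyIncr-word⇒row _ w₃ w₃∈ (proj₁ (T-∧⁻ incr₃))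
  with L₁≤N₁ , rest₃ ← T-∧⁻ (subst T (sym contained) _)
  = tableau-of-rows p₁ q₁ p₂ q₂ p₃ q₃ L₂≤L₁ N₂≤N₁ N₃≤N₂
      (ℕP.≤ᵇ⇒≤ L₁ N₁ L₁≤N₁) (ℕP.≤ᵇ⇒≤ L₂ N₂ (proj₁ (T-∧⁻ rest₃)))
      len₁ len₂ len₃ cols content lattice

-- The chamber complex

Ray : Set
Ray = Fin 9

pattern 𝐛  = zero
pattern 𝐜  = suc zero
pattern 𝐟  = suc (suc zero)
pattern 𝐝₁ = suc (suc (suc zero))
pattern 𝐞₁ = suc (suc (suc (suc zero)))
pattern 𝐠₁ = suc (suc (suc (suc (suc zero))))
pattern 𝐝₂ = suc (suc (suc (suc (suc (suc zero)))))
pattern 𝐞₂ = suc (suc (suc (suc (suc (suc (suc zero))))))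
pattern 𝐠₂ = suc (suc (suc (suc (suc (suc (suc (suc zero)))))))

ray : Ray → ℤ⁶
ray 𝐛  = rb
ray 𝐜  = rc
ray 𝐟  = rf
ray 𝐝₁ = rd₁
ray 𝐞₁ = re₁
ray 𝐠₁ = rg₁
ray 𝐝₂ = rd₂
ray 𝐞₂ = re₂
ray 𝐠₂ = rg₂

chamberRays : Fin 18 → Vec Ray 6
chamberRays = lookup
  ( (𝐛 ∷ 𝐜 ∷ 𝐝₁ ∷ 𝐞₂ ∷ 𝐝₂ ∷ 𝐞₁ ∷ [])
  ∷ (𝐛 ∷ 𝐜 ∷ 𝐝₁ ∷ 𝐠₁ ∷ 𝐝₂ ∷ 𝐠₂ ∷ [])
  ∷ (𝐛 ∷ 𝐜 ∷ 𝐞₂ ∷ 𝐠₁ ∷ 𝐞₁ ∷ 𝐠₂ ∷ [])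
  ∷ (𝐛 ∷ 𝐟 ∷ 𝐝₁ ∷ 𝐞₂ ∷ 𝐝₂ ∷ 𝐞₁ ∷ [])
  ∷ (𝐛 ∷ 𝐟 ∷ 𝐝₁ ∷ 𝐠₁ ∷ 𝐝₂ ∷ 𝐠₂ ∷ [])
  ∷ (𝐛 ∷ 𝐟 ∷ 𝐞₂ ∷ 𝐠₁ ∷ 𝐞₁ ∷ 𝐠₂ ∷ [])
  ∷ (𝐛 ∷ 𝐜 ∷ 𝐝₁ ∷ 𝐠₁ ∷ 𝐝₂ ∷ 𝐞₁ ∷ [])
  ∷ (𝐛 ∷ 𝐜 ∷ 𝐝₁ ∷ 𝐞₂ ∷ 𝐝₂ ∷ 𝐠₂ ∷ [])
  ∷ (𝐛 ∷ 𝐜 ∷ 𝐝₁ ∷ 𝐞₂ ∷ 𝐞₁ ∷ 𝐠₂ ∷ [])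
  ∷ (𝐛 ∷ 𝐜 ∷ 𝐞₂ ∷ 𝐠₁ ∷ 𝐝₂ ∷ 𝐞₁ ∷ [])
  ∷ (𝐛 ∷ 𝐜 ∷ 𝐝₁ ∷ 𝐠₁ ∷ 𝐞₁ ∷ 𝐠₂ ∷ [])
  ∷ (𝐛 ∷ 𝐜 ∷ 𝐞₂ ∷ 𝐠₁ ∷ 𝐝₂ ∷ 𝐠₂ ∷ [])
  ∷ (𝐛 ∷ 𝐟 ∷ 𝐝₁ ∷ 𝐠₁ ∷ 𝐝₂ ∷ 𝐞₁ ∷ [])
  ∷ (𝐛 ∷ 𝐟 ∷ 𝐝₁ ∷ 𝐞₂ ∷ 𝐝₂ ∷ 𝐠₂ ∷ [])
  ∷ (𝐛 ∷ 𝐟 ∷ 𝐝₁ ∷ 𝐠₁ ∷ 𝐞₁ ∷ 𝐠₂ ∷ [])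
  ∷ (𝐛 ∷ 𝐟 ∷ 𝐞₂ ∷ 𝐠₁ ∷ 𝐝₂ ∷ 𝐠₂ ∷ [])
  ∷ (𝐛 ∷ 𝐟 ∷ 𝐝₁ ∷ 𝐞₂ ∷ 𝐞₁ ∷ 𝐠₂ ∷ [])
  ∷ (𝐛 ∷ 𝐟 ∷ 𝐞₂ ∷ 𝐠₁ ∷ 𝐝₂ ∷ 𝐞₁ ∷ [])
  ∷ [])

chamberRay : Fin 18 → Fin 6 → Ray
chamberRay k = lookup (chamberRays k)

generator : Fin 18 → Fin 6 → ℤ⁶
generator k = lookup (chamberGens k)

generator≗ray : ∀ k i → generator k i ≗ ray (chamberRay k i)
generator≗ray = decide (FinP.all? λ k → FinP.all? λ i → FinP.all? λ j →
                          generator k i j ℤ.≟ ray (chamberRay k i) j) refl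

-- facet k is P_κ − 1 for the polynomial P_κ of the chamber κ = κ_{k+1}; it is the
-- 𝐛-coordinate of a point of that chamber.
facets : Vec ℤ⁶ 18
facets =
  ( vec6    0ℤ   -1ℤ    0ℤ   -1ℤ    1ℤ    0ℤ
  ∷ vec6   -1ℤ   -1ℤ   -1ℤ   -1ℤ    1ℤ (+ 2)
  ∷ vec6    1ℤ    0ℤ    1ℤ    0ℤ   -1ℤ    0ℤ
  ∷ vec6    0ℤ    0ℤ    0ℤ    0ℤ    1ℤ   -1ℤ
  ∷ vec6   -1ℤ    0ℤ   -1ℤ    0ℤ    1ℤ    1ℤ
  ∷ vec6    1ℤ    1ℤ    1ℤ    1ℤ   -1ℤ   -1ℤ
  ∷ vec6   -1ℤ   -1ℤ    0ℤ   -1ℤ    1ℤ    1ℤ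
  ∷ vec6    0ℤ   -1ℤ   -1ℤ   -1ℤ    1ℤ    1ℤ
  ∷ vec6    1ℤ   -1ℤ    0ℤ    0ℤ    0ℤ    0ℤ
  ∷ vec6    0ℤ    0ℤ    1ℤ   -1ℤ    0ℤ    0ℤ
  ∷ vec6    0ℤ   -1ℤ    0ℤ    0ℤ    0ℤ    1ℤ
  ∷ vec6    0ℤ    0ℤ    0ℤ   -1ℤ    0ℤ    1ℤ
  ∷ vec6   -1ℤ    0ℤ    0ℤ    0ℤ    1ℤ    0ℤ
  ∷ vec6    0ℤ    0ℤ   -1ℤ    0ℤ    1ℤ    0ℤ
  ∷ vec6    0ℤ    0ℤ    0ℤ    1ℤ    0ℤ    0ℤ
  ∷ vec6    0ℤ    1ℤ    0ℤ    0ℤ    0ℤ    0ℤ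
  ∷ vec6    1ℤ    0ℤ    0ℤ    1ℤ    0ℤ   -1ℤ
  ∷ vec6    0ℤ    1ℤ    1ℤ    0ℤ    0ℤ   -1ℤ
  ∷ [])

facet : Fin 18 → ℤ⁶
facet = lookup facets

InK : ℤ⁶ → Set
InK x = ∀ k → + 0 ℤ.≤ dot (facet k) x

-- The non-𝐛 rays fall into three blocks {𝐜, 𝐟}, {𝐝₁, 𝐠₁, 𝐞₂} and {𝐞₁, 𝐝₂, 𝐠₂}.  A point
-- lies in the chamber omitting, from each block, a ray of least potential, and
-- its coordinate along any other ray of the block is the excess potential.
potential : Ray → ℤ⁶
potential 𝐟  = vec6    0ℤ   -1ℤ    0ℤ   -1ℤ    0ℤ    1ℤ
potential 𝐝₁ = vec6    0ℤ    1ℤ    1ℤ    0ℤ   -1ℤ    0ℤ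
potential 𝐞₂ = vec6   -1ℤ    0ℤ    0ℤ    0ℤ    0ℤ    1ℤ
potential 𝐞₁ = vec6    0ℤ    0ℤ   -1ℤ    0ℤ    0ℤ    1ℤ
potential 𝐝₂ = vec6    1ℤ    0ℤ    0ℤ    1ℤ   -1ℤ    0ℤ
potential _  = vec6    0ℤ    0ℤ    0ℤ    0ℤ    0ℤ    0ℤ

Minimizers : Set
Minimizers = Fin 2 × Fin 3 × Fin 3

blockMinimizer : Minimizers → Ray → Ray
blockMinimizer (s , u , v) r = pick r
  where
  pick : Ray → Ray
  pick 𝐜  = lookup (𝐜 ∷ 𝐟 ∷ []) s
  pick 𝐟  = lookup (𝐜 ∷ 𝐟 ∷ []) s
  pick 𝐝₁ = lookup (𝐝₁ ∷ 𝐠₁ ∷ 𝐞₂ ∷ []) u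
  pick 𝐠₁ = lookup (𝐝₁ ∷ 𝐠₁ ∷ 𝐞₂ ∷ []) u
  pick 𝐞₂ = lookup (𝐝₁ ∷ 𝐠₁ ∷ 𝐞₂ ∷ []) u
  pick 𝐞₁ = lookup (𝐞₁ ∷ 𝐝₂ ∷ 𝐠₂ ∷ []) v
  pick 𝐝₂ = lookup (𝐞₁ ∷ 𝐝₂ ∷ 𝐠₂ ∷ []) v
  pick 𝐠₂ = lookup (𝐞₁ ∷ 𝐝₂ ∷ 𝐠₂ ∷ []) v
  pick 𝐛  = 𝐛

coordinateForm : Fin 18 → Minimizers → Ray → ℤ⁶
coordinateForm k m 𝐛 = facet k
coordinateForm k m r = potential r ⊖ potential (blockMinimizer m r)

DualToRays : Fin 18 → Minimizers → Set
DualToRays k m =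
  ∀ a j → sumFin (λ i → coordinateForm k m (chamberRay k i) a * ray (chamberRay k i) j) ≡ idMat a j

opaque
  chamber-coordinates : ∀ s u v → ∃ λ k → DualToRays k (s , u , v)
  chamber-coordinates = decide
    (FinP.all? λ s → FinP.all? λ u → FinP.all? λ v → FinP.any? λ k → FinP.all? λ a → FinP.all? λ j →
       sumFin (λ i → coordinateForm k (s , u , v) (chamberRay k i) a * ray (chamberRay k i) j) ℤ.≟ idMat a j)
    refl

argmin : ∀ {n} (f : Fin (suc n) → ℤ) → ∃ λ m → ∀ i → f m ℤ.≤ f i
argmin {zero}  f = zero , λ { zero → ℤP.≤-refl }
argmin {suc n} f with m , f[m]≤ ← argmin (λ i → f (suc i)) | ℤP.≤-total (f zero) (f (suc m))
... | inj₁ f₀≤f[m] = zero , λ { zero → ℤP.≤-refl ; (suc i) → ℤP.≤-trans f₀≤f[m] (f[m]≤ i) }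
... | inj₂ f[m]≤f₀ = suc m , λ { zero → f[m]≤f₀ ; (suc i) → f[m]≤ i }

Minimizing : Minimizers → ℤ⁶ → Set
Minimizing m x = ∀ r → dot (potential (blockMinimizer m r)) x ℤ.≤ dot (potential r) x

minimizers : ∀ x → ∃ λ m → Minimizing m x
minimizers x
  with s , s-min ← argmin (λ s → dot (potential (lookup (𝐜 ∷ 𝐟 ∷ []) s)) x)
     | u , u-min ← argmin (λ u → dot (potential (lookup (𝐝₁ ∷ 𝐠₁ ∷ 𝐞₂ ∷ []) u)) x)
     | v , v-min ← argmin (λ v → dot (potential (lookup (𝐞₁ ∷ 𝐝₂ ∷ 𝐠₂ ∷ []) v)) x)
  = (s , u , v) , λ where
      𝐛  → ℤP.≤-refl
      𝐜  → s-min (# 0)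
      𝐟  → s-min (# 1)
      𝐝₁ → u-min (# 0)
      𝐠₁ → u-min (# 1)
      𝐞₂ → u-min (# 2)
      𝐞₁ → v-min (# 0)
      𝐝₂ → v-min (# 1)
      𝐠₂ → v-min (# 2)

coordinateForm-nonneg : ∀ {x} k m → InK x → Minimizing m x → ∀ r → + 0 ℤ.≤ dot (coordinateForm k m r) x
coordinateForm-nonneg     k m x∈K min 𝐛       = x∈K k
coordinateForm-nonneg {x} k m x∈K min r@(suc _) =
  subst (+ 0 ℤ.≤_) (sym (dot-⊖ (potential r) (potential (blockMinimizer m r)) x)) (ℤP.i≤j⇒0≤j-i (min r))

InChamber : Fin 18 → ℤ⁶ → Set
InChamber k x = ∃ λ (a : Fin 6 → ℕ) → x ≗ lincomb (λ i → + a i) (generator k)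

opaque
  K⊆chambers : ∀ x → InK x → ∃ λ k → InChamber k x
  K⊆chambers x x∈K with (s , u , v) , min ← minimizers x with k , inverse ← chamber-coordinates s u v =
    k , (λ i → ∣ coordinate i ∣) , λ j → begin
      x j                                                             ≡⟨ lincomb-dualBasis F G inverse x j ⟨
      sumFin (λ i → coordinate i * G i j)                             ≡⟨ sumFin-cong (λ i → cong₂ _*_
                                                                           (sym (ℤP.0≤i⇒+∣i∣≡i (nonneg i)))
                                                                           (sym (generator≗ray k i j))) ⟩
      sumFin (λ i → + ∣ coordinate i ∣ * generator k i j)             ∎
    where
    open ≡-Reasoning
    F G : Fin 6 → ℤ⁶
    m : Minimizers
    m = (s , u , v)
    F i = coordinateForm k m (chamberRay k i)
    G i = ray (chamberRay k i)
    coordinate : Fin 6 → ℤ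
    coordinate i = dot (F i) x
    nonneg : ∀ i → + 0 ℤ.≤ coordinate i
    nonneg i = coordinateForm-nonneg {x} k m x∈K min (chamberRay k i)

-- The support of C lies in K

private
  facet-value₀ : ∀ L₁ L₂ p₁ p₂ p₃ q₂ q₃ →
    0ℤ * L₁ + (-1ℤ * L₂ + (0ℤ * (p₁ + p₂ + p₃) + (-1ℤ * (q₂ + q₃) + (1ℤ * (L₁ + p₁) + (0ℤ * (L₂ + p₂ + q₂) + 0ℤ)))))
    ≡ (L₁ - (L₂ + p₂)) + ((p₁ + p₂) - (q₂ + q₃))
  facet-value₀ = solve-∀
  facet-value₁ : ∀ L₁ L₂ p₁ p₂ p₃ q₂ q₃ →
    -1ℤ * L₁ + (-1ℤ * L₂ + (-1ℤ * (p₁ + p₂ + p₃) + (-1ℤ * (q₂ + q₃) + (1ℤ * (L₁ + p₁) + (+ 2 * (L₂ + p₂ + q₂) + 0ℤ)))))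
    ≡ ((L₂ + p₂) - (p₃ + q₃)) + q₂
  facet-value₁ = solve-∀
  facet-value₂ : ∀ L₁ L₂ p₁ p₂ p₃ q₂ q₃ →
    1ℤ * L₁ + (0ℤ * L₂ + (1ℤ * (p₁ + p₂ + p₃) + (0ℤ * (q₂ + q₃) + (-1ℤ * (L₁ + p₁) + (0ℤ * (L₂ + p₂ + q₂) + 0ℤ)))))
    ≡ p₂ + p₃
  facet-value₂ = solve-∀
  facet-value₃ : ∀ L₁ L₂ p₁ p₂ p₃ q₂ q₃ →
    0ℤ * L₁ + (0ℤ * L₂ + (0ℤ * (p₁ + p₂ + p₃) + (0ℤ * (q₂ + q₃) + (1ℤ * (L₁ + p₁) + (-1ℤ * (L₂ + p₂ + q₂) + 0ℤ)))))
    ≡ (L₁ - (L₂ + p₂)) + (p₁ - q₂)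
  facet-value₃ = solve-∀
  facet-value₄ : ∀ L₁ L₂ p₁ p₂ p₃ q₂ q₃ →
    -1ℤ * L₁ + (0ℤ * L₂ + (-1ℤ * (p₁ + p₂ + p₃) + (0ℤ * (q₂ + q₃) + (1ℤ * (L₁ + p₁) + (1ℤ * (L₂ + p₂ + q₂) + 0ℤ)))))
    ≡ (L₂ - p₃) + q₂
  facet-value₄ = solve-∀
  facet-value₅ : ∀ L₁ L₂ p₁ p₂ p₃ q₂ q₃ →
    1ℤ * L₁ + (1ℤ * L₂ + (1ℤ * (p₁ + p₂ + p₃) + (1ℤ * (q₂ + q₃) + (-1ℤ * (L₁ + p₁) + (-1ℤ * (L₂ + p₂ + q₂) + 0ℤ)))))
    ≡ p₃ + q₃
  facet-value₅ = solve-∀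
  facet-value₆ : ∀ L₁ L₂ p₁ p₂ p₃ q₂ q₃ →
    -1ℤ * L₁ + (-1ℤ * L₂ + (0ℤ * (p₁ + p₂ + p₃) + (-1ℤ * (q₂ + q₃) + (1ℤ * (L₁ + p₁) + (1ℤ * (L₂ + p₂ + q₂) + 0ℤ)))))
    ≡ ((p₁ + p₂) - (q₂ + q₃)) + q₂
  facet-value₆ = solve-∀
  facet-value₇ : ∀ L₁ L₂ p₁ p₂ p₃ q₂ q₃ →
    0ℤ * L₁ + (-1ℤ * L₂ + (-1ℤ * (p₁ + p₂ + p₃) + (-1ℤ * (q₂ + q₃) + (1ℤ * (L₁ + p₁) + (1ℤ * (L₂ + p₂ + q₂) + 0ℤ)))))
    ≡ (L₁ - (L₂ + p₂)) + ((L₂ + p₂) - (p₃ + q₃))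
  facet-value₇ = solve-∀
  facet-value₈ : ∀ L₁ L₂ p₁ p₂ p₃ q₂ q₃ →
    1ℤ * L₁ + (-1ℤ * L₂ + (0ℤ * (p₁ + p₂ + p₃) + (0ℤ * (q₂ + q₃) + (0ℤ * (L₁ + p₁) + (0ℤ * (L₂ + p₂ + q₂) + 0ℤ)))))
    ≡ (L₁ - (L₂ + p₂)) + p₂
  facet-value₈ = solve-∀
  facet-value₉ : ∀ L₁ L₂ p₁ p₂ p₃ q₂ q₃ →
    0ℤ * L₁ + (0ℤ * L₂ + (1ℤ * (p₁ + p₂ + p₃) + (-1ℤ * (q₂ + q₃) + (0ℤ * (L₁ + p₁) + (0ℤ * (L₂ + p₂ + q₂) + 0ℤ)))))
    ≡ ((p₁ + p₂) - (q₂ + q₃)) + p₃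
  facet-value₉ = solve-∀
  facet-value₁₀ : ∀ L₁ L₂ p₁ p₂ p₃ q₂ q₃ →
    0ℤ * L₁ + (-1ℤ * L₂ + (0ℤ * (p₁ + p₂ + p₃) + (0ℤ * (q₂ + q₃) + (0ℤ * (L₁ + p₁) + (1ℤ * (L₂ + p₂ + q₂) + 0ℤ)))))
    ≡ p₂ + q₂
  facet-value₁₀ = solve-∀
  facet-value₁₁ : ∀ L₁ L₂ p₁ p₂ p₃ q₂ q₃ →
    0ℤ * L₁ + (0ℤ * L₂ + (0ℤ * (p₁ + p₂ + p₃) + (-1ℤ * (q₂ + q₃) + (0ℤ * (L₁ + p₁) + (1ℤ * (L₂ + p₂ + q₂) + 0ℤ)))))
    ≡ ((L₂ + p₂) - (p₃ + q₃)) + p₃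
  facet-value₁₁ = solve-∀
  facet-value₁₂ : ∀ L₁ L₂ p₁ p₂ p₃ q₂ q₃ →
    -1ℤ * L₁ + (0ℤ * L₂ + (0ℤ * (p₁ + p₂ + p₃) + (0ℤ * (q₂ + q₃) + (1ℤ * (L₁ + p₁) + (0ℤ * (L₂ + p₂ + q₂) + 0ℤ)))))
    ≡ p₁
  facet-value₁₂ = solve-∀
  facet-value₁₃ : ∀ L₁ L₂ p₁ p₂ p₃ q₂ q₃ →
    0ℤ * L₁ + (0ℤ * L₂ + (-1ℤ * (p₁ + p₂ + p₃) + (0ℤ * (q₂ + q₃) + (1ℤ * (L₁ + p₁) + (0ℤ * (L₂ + p₂ + q₂) + 0ℤ)))))
    ≡ (L₁ - (L₂ + p₂)) + (L₂ - p₃)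
  facet-value₁₃ = solve-∀
  facet-value₁₄ : ∀ L₁ L₂ p₁ p₂ p₃ q₂ q₃ →
    0ℤ * L₁ + (0ℤ * L₂ + (0ℤ * (p₁ + p₂ + p₃) + (1ℤ * (q₂ + q₃) + (0ℤ * (L₁ + p₁) + (0ℤ * (L₂ + p₂ + q₂) + 0ℤ)))))
    ≡ q₂ + q₃
  facet-value₁₄ = solve-∀
  facet-value₁₅ : ∀ L₁ L₂ p₁ p₂ p₃ q₂ q₃ →
    0ℤ * L₁ + (1ℤ * L₂ + (0ℤ * (p₁ + p₂ + p₃) + (0ℤ * (q₂ + q₃) + (0ℤ * (L₁ + p₁) + (0ℤ * (L₂ + p₂ + q₂) + 0ℤ)))))
    ≡ L₂
  facet-value₁₅ = solve-∀
  facet-value₁₆ : ∀ L₁ L₂ p₁ p₂ p₃ q₂ q₃ →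
    1ℤ * L₁ + (0ℤ * L₂ + (0ℤ * (p₁ + p₂ + p₃) + (1ℤ * (q₂ + q₃) + (0ℤ * (L₁ + p₁) + (-1ℤ * (L₂ + p₂ + q₂) + 0ℤ)))))
    ≡ (L₁ - (L₂ + p₂)) + q₃
  facet-value₁₆ = solve-∀
  facet-value₁₇ : ∀ L₁ L₂ p₁ p₂ p₃ q₂ q₃ →
    0ℤ * L₁ + (1ℤ * L₂ + (1ℤ * (p₁ + p₂ + p₃) + (0ℤ * (q₂ + q₃) + (0ℤ * (L₁ + p₁) + (-1ℤ * (L₂ + p₂ + q₂) + 0ℤ)))))
    ≡ (p₁ - q₂) + p₃
  facet-value₁₇ = solve-∀


-- Each facet of K, evaluated at the point of an LR tableau, is a sum of two of the
-- quantities that LRTableau proves nonnegative.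
tableau∈K : ∀ {L₁ L₂ M₁ M₂ N₁ N₂} → LRTableau L₁ L₂ M₁ M₂ N₁ N₂ →
            InK (vec6 (+ L₁) (+ L₂) (+ M₁) (+ M₂) (+ N₁) (+ N₂))
tableau∈K {L₁} {L₂} record { p₁ = p₁ ; p₂ = p₂ ; p₃ = p₃ ; q₂ = q₂ ; q₃ = q₃
                            ; N₁≡ = refl ; N₂≡ = refl ; M₁≡ = refl ; M₂≡ = refl
                            ; L₂+p₂≤L₁ = L₂+p₂≤L₁ ; p₃≤L₂ = p₃≤L₂ ; p₃+q₃≤L₂+p₂ = p₃+q₃≤L₂+p₂
                            ; q₂≤p₁ = q₂≤p₁ ; q₂+q₃≤p₁+p₂ = q₂+q₃≤p₁+p₂ }
  = lookup⁺ values
  where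
  atTableau : {P : ℤ → ℤ → ℤ → ℤ → ℤ → ℤ → ℤ → Set} →
       (∀ L₁ L₂ p₁ p₂ p₃ q₂ q₃ → P L₁ L₂ p₁ p₂ p₃ q₂ q₃) → P (+ L₁) (+ L₂) (+ p₁) (+ p₂) (+ p₃) (+ q₂) (+ q₃)
  atTableau identity = identity (+ L₁) (+ L₂) (+ p₁) (+ p₂) (+ p₃) (+ q₂) (+ q₃)
  nat : ∀ n → + 0 ℤ.≤ + n
  nat n = ℤ.+≤+ z≤n
  slack : ∀ {m n} → m ℕ.≤ n → + 0 ℤ.≤ + n - + m
  slack m≤n = ℤP.i≤j⇒0≤j-i (ℤ.+≤+ m≤n)
  nonneg₂ : ∀ {v a b} → v ≡ a + b → + 0 ℤ.≤ a → + 0 ℤ.≤ b → + 0 ℤ.≤ v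
  nonneg₂ v≡a+b 0≤a 0≤b = subst (+ 0 ℤ.≤_) (sym v≡a+b) (ℤP.+-mono-≤ 0≤a 0≤b)
  nonneg₁ : ∀ {v a} → v ≡ a → + 0 ℤ.≤ a → + 0 ℤ.≤ v
  nonneg₁ v≡a 0≤a = subst (+ 0 ℤ.≤_) (sym v≡a) 0≤a
  values : VecAll (λ h → + 0 ℤ.≤ dot h (vec6 (+ L₁) (+ L₂) (+ (p₁ ℕ.+ p₂ ℕ.+ p₃)) (+ (q₂ ℕ.+ q₃)) (+ (L₁ ℕ.+ p₁)) (+ (L₂ ℕ.+ p₂ ℕ.+ q₂)))) facets
  values =
    ( nonneg₂ (atTableau facet-value₀) (slack L₂+p₂≤L₁) (slack q₂+q₃≤p₁+p₂)
    ∷ nonneg₂ (atTableau facet-value₁) (slack p₃+q₃≤L₂+p₂) (nat q₂)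
    ∷ nonneg₂ (atTableau facet-value₂) (nat p₂) (nat p₃)
    ∷ nonneg₂ (atTableau facet-value₃) (slack L₂+p₂≤L₁) (slack q₂≤p₁)
    ∷ nonneg₂ (atTableau facet-value₄) (slack p₃≤L₂) (nat q₂)
    ∷ nonneg₂ (atTableau facet-value₅) (nat p₃) (nat q₃)
    ∷ nonneg₂ (atTableau facet-value₆) (slack q₂+q₃≤p₁+p₂) (nat q₂)
    ∷ nonneg₂ (atTableau facet-value₇) (slack L₂+p₂≤L₁) (slack p₃+q₃≤L₂+p₂)
    ∷ nonneg₂ (atTableau facet-value₈) (slack L₂+p₂≤L₁) (nat p₂)
    ∷ nonneg₂ (atTableau facet-value₉) (slack q₂+q₃≤p₁+p₂) (nat p₃)
    ∷ nonneg₂ (atTableau facet-value₁₀) (nat p₂) (nat q₂)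
    ∷ nonneg₂ (atTableau facet-value₁₁) (slack p₃+q₃≤L₂+p₂) (nat p₃)
    ∷ nonneg₁ (atTableau facet-value₁₂) (nat p₁)
    ∷ nonneg₂ (atTableau facet-value₁₃) (slack L₂+p₂≤L₁) (slack p₃≤L₂)
    ∷ nonneg₂ (atTableau facet-value₁₄) (nat q₂) (nat q₃)
    ∷ nonneg₁ (atTableau facet-value₁₅) (nat L₂)
    ∷ nonneg₂ (atTableau facet-value₁₆) (slack L₂+p₂≤L₁) (nat q₃)
    ∷ nonneg₂ (atTableau facet-value₁₇) (slack q₂≤p₁) (nat p₃)
    ∷ [])

private
  if-nonzero : ∀ b (t : ℤ) → (if b then t else + 0) ≢ + 0 → T b × t ≢ + 0
  if-nonzero true  t t≢0 = _ , t≢0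
  if-nonzero false t 0≢0 = ⊥-elim (0≢0 refl)

  ≤ᵇ⇒≤ : ∀ {i j} → T (i ℤ.≤ᵇ j) → i ℤ.≤ j
  ≤ᵇ⇒≤ = ℤP.≤ᵇ⇒≤

  ∣∣-mono : ∀ {i j} → + 0 ℤ.≤ i → i ℤ.≤ j → ∣ i ∣ ℕ.≤ ∣ j ∣
  ∣∣-mono {i} {j} 0≤i i≤j = ℤP.drop‿+≤+ (subst₂ ℤ._≤_ (sym (ℤP.0≤i⇒+∣i∣≡i 0≤i))
                                                  (sym (ℤP.0≤i⇒+∣i∣≡i (ℤP.≤-trans 0≤i i≤j))) i≤j)

vec6-η : ∀ (x : ℤ⁶) → vec6 (x zero) (x (suc zero)) (x (suc (suc zero))) (x (suc (suc (suc zero))))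
                            (x (suc (suc (suc (suc zero))))) (x (suc (suc (suc (suc (suc zero)))))) ≗ x
vec6-η x zero                                = refl
vec6-η x (suc zero)                          = refl
vec6-η x (suc (suc zero))                    = refl
vec6-η x (suc (suc (suc zero)))              = refl
vec6-η x (suc (suc (suc (suc zero))))        = refl
vec6-η x (suc (suc (suc (suc (suc zero))))) = refl

opaque
  support⊆K : ∀ x → C x ≢ + 0 → InK x
  support⊆K x Cx≢0 k =
    subst (+ 0 ℤ.≤_) (dot-cong (facet k) (vec6-η x)) (vec6-support⊆K _ _ _ _ _ _ Cx≢0 k)
    where
    vec6-support⊆K : ∀ l₁ l₂ m₁ m₂ n₁ n₂ → C (vec6 l₁ l₂ m₁ m₂ n₁ n₂) ≢ + 0 → InK (vec6 l₁ l₂ m₁ m₂ n₁ n₂)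
    vec6-support⊆K l₁ l₂ m₁ m₂ n₁ n₂ C≢0
      with guard , LR≢0 ← if-nonzero _ _ C≢0
      with l₂≤ᵇl₁ , guard ← T-∧⁻ {l₂ ℤ.≤ᵇ l₁} guard
      with 0≤ᵇl₂ , guard ← T-∧⁻ {+ 0 ℤ.≤ᵇ l₂} guard
      with m₂≤ᵇm₁ , guard ← T-∧⁻ {m₂ ℤ.≤ᵇ m₁} guard
      with 0≤ᵇm₂ , guard ← T-∧⁻ {+ 0 ℤ.≤ᵇ m₂} guard
      with n₂≤ᵇn₁ , guard ← T-∧⁻ {n₂ ℤ.≤ᵇ n₁} guard
      with n₃≤ᵇn₂ , 0≤ᵇn₃  ← T-∧⁻ {l₁ + l₂ + m₁ + m₂ - n₁ - n₂ ℤ.≤ᵇ n₂} guard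
      = λ k → subst (+ 0 ℤ.≤_) (dot-cong (facet k) ∣x∣≗x) (tableau∈K tableau k)
      where
      n₃ : ℤ
      n₃ = l₁ + l₂ + m₁ + m₂ - n₁ - n₂
      l₂≤l₁ : l₂ ℤ.≤ l₁
      l₂≤l₁ = ≤ᵇ⇒≤ l₂≤ᵇl₁
      0≤l₂ : + 0 ℤ.≤ l₂
      0≤l₂ = ≤ᵇ⇒≤ 0≤ᵇl₂
      m₂≤m₁ : m₂ ℤ.≤ m₁
      m₂≤m₁ = ≤ᵇ⇒≤ m₂≤ᵇm₁
      0≤m₂ : + 0 ℤ.≤ m₂
      0≤m₂ = ≤ᵇ⇒≤ 0≤ᵇm₂
      n₂≤n₁ : n₂ ℤ.≤ n₁
      n₂≤n₁ = ≤ᵇ⇒≤ n₂≤ᵇn₁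
      n₃≤n₂ : n₃ ℤ.≤ n₂
      n₃≤n₂ = ≤ᵇ⇒≤ n₃≤ᵇn₂
      0≤n₃ : + 0 ℤ.≤ n₃
      0≤n₃ = ≤ᵇ⇒≤ 0≤ᵇn₃
      0≤l₁ : + 0 ℤ.≤ l₁
      0≤l₁ = ℤP.≤-trans 0≤l₂ l₂≤l₁
      0≤m₁ : + 0 ℤ.≤ m₁
      0≤m₁ = ℤP.≤-trans 0≤m₂ m₂≤m₁
      0≤n₂ : + 0 ℤ.≤ n₂
      0≤n₂ = ℤP.≤-trans 0≤n₃ n₃≤n₂
      0≤n₁ : + 0 ℤ.≤ n₁
      0≤n₁ = ℤP.≤-trans 0≤n₂ n₂≤n₁
      ∣x∣≗x : vec6 (+ ∣ l₁ ∣) (+ ∣ l₂ ∣) (+ ∣ m₁ ∣) (+ ∣ m₂ ∣) (+ ∣ n₁ ∣) (+ ∣ n₂ ∣) ≗ vec6 l₁ l₂ m₁ m₂ n₁ n₂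
      ∣x∣≗x zero                                = ℤP.0≤i⇒+∣i∣≡i 0≤l₁
      ∣x∣≗x (suc zero)                          = ℤP.0≤i⇒+∣i∣≡i 0≤l₂
      ∣x∣≗x (suc (suc zero))                    = ℤP.0≤i⇒+∣i∣≡i 0≤m₁
      ∣x∣≗x (suc (suc (suc zero)))              = ℤP.0≤i⇒+∣i∣≡i 0≤m₂
      ∣x∣≗x (suc (suc (suc (suc zero))))        = ℤP.0≤i⇒+∣i∣≡i 0≤n₁
      ∣x∣≗x (suc (suc (suc (suc (suc zero))))) = ℤP.0≤i⇒+∣i∣≡i 0≤n₂
      tableau : LRTableau (∣ l₁ ∣) (∣ l₂ ∣) (∣ m₁ ∣) (∣ m₂ ∣) (∣ n₁ ∣) (∣ n₂ ∣)
      tableau = LR-nonzero⇒tableau (∣ l₁ ∣) (∣ l₂ ∣) (∣ m₁ ∣) (∣ m₂ ∣) (∣ n₁ ∣) (∣ n₂ ∣) (∣ n₃ ∣)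
                  (∣∣-mono 0≤l₂ l₂≤l₁) (∣∣-mono 0≤n₂ n₂≤n₁) (∣∣-mono 0≤n₃ n₃≤n₂)
                  (λ LR≡0 → LR≢0 (cong +_ LR≡0))

-- A height on the support of C

2≰1 : ¬ (2 ≤ 1)
2≰1 (s≤s ())

4≰3 : ¬ (4 ≤ 3)
4≰3 (s≤s (s≤s (s≤s ())))

private
  multiplicity-one : ∀ k w t → 2 ≤ w → suc k ℕ.* w ℕ.+ t ≤ 3 → k ≡ 0
  multiplicity-one zero     w t 2≤w _  = refl
  multiplicity-one (suc k′) w t 2≤w ≤3 = ⊥-elim (4≰3 (begin
    4                                    ≤⟨ ℕP.+-mono-≤ 2≤w (ℕP.≤-trans 2≤w (ℕP.m≤m+n w _)) ⟩
    w ℕ.+ (w ℕ.+ k′ ℕ.* w)               ≤⟨ ℕP.m≤m+n _ t ⟩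
    suc (suc k′) ℕ.* w ℕ.+ t             ≤⟨ ≤3 ⟩
    3                                    ∎))
    where open ℕP.≤-Reasoning

∑-small⇒zero : ∀ {n} (a w : Fin n → ℕ) → (∀ i → 2 ≤ w i) → ∑ (λ i → a i ℕ.* w i) ≤ 1 → ∀ i → a i ≡ 0
∑-small⇒zero {suc n} a w 2≤w ∑≤1 i with a zero in a₀≡
... | suc k = ⊥-elim (2≰1 (begin
      2                                        ≤⟨ 2≤w zero ⟩
      w zero                                   ≤⟨ ℕP.m≤m+n (w zero) (k ℕ.* w zero) ⟩
      suc k ℕ.* w zero                         ≤⟨ ℕP.m≤m+n _ (∑ (λ i → a (suc i) ℕ.* w (suc i))) ⟩
      suc k ℕ.* w zero ℕ.+ ∑ (λ i → a (suc i) ℕ.* w (suc i)) ≤⟨ ∑≤1 ⟩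
      1                                        ∎))
  where open ℕP.≤-Reasoning
... | zero with i
...   | zero  = a₀≡
...   | suc i = ∑-small⇒zero (λ i → a (suc i)) (λ i → w (suc i)) (λ i → 2≤w (suc i)) ∑≤1 i

∑-small⇒unit : ∀ {n} (a w : Fin n → ℕ) → (∀ i → 2 ≤ w i) → ∑ (λ i → a i ℕ.* w i) ≤ 3 →
               (∀ i → a i ≡ 0) ⊎ ∃ λ i → a i ≡ 1 × ∀ j → j ≢ i → a j ≡ 0
∑-small⇒unit {zero}  a w 2≤w ∑≤3 = inj₁ λ ()
∑-small⇒unit {suc n} a w 2≤w ∑≤3 with a zero in a₀≡
... | zero with ∑-small⇒unit (λ i → a (suc i)) (λ i → w (suc i)) (λ i → 2≤w (suc i)) ∑≤3
...   | inj₁ tail≡0 = inj₁ λ { zero → a₀≡ ; (suc i) → tail≡0 i }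
...   | inj₂ (i , aᵢ≡1 , others≡0) =
          inj₂ (suc i , aᵢ≡1 , λ { zero _ → a₀≡ ; (suc j) j≢i → others≡0 j (j≢i ∘ cong suc) })
∑-small⇒unit {suc n} a w 2≤w ∑≤3 | suc k =
  inj₂ (zero , trans a₀≡ (cong suc k≡0) , λ { zero 0≢0 → ⊥-elim (0≢0 refl) ; (suc j) _ → tail≡0 j })
  where
  open ℕP.≤-Reasoning
  tail = ∑ (λ i → a (suc i) ℕ.* w (suc i))
  tail≤1 : tail ≤ 1
  tail≤1 = ℕP.+-cancelˡ-≤ 2 tail 1 (begin
    2 ℕ.+ tail                ≤⟨ ℕP.+-monoˡ-≤ tail (ℕP.≤-trans (2≤w zero) (ℕP.m≤m+n (w zero) (k ℕ.* w zero))) ⟩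
    suc k ℕ.* w zero ℕ.+ tail ≤⟨ ∑≤3 ⟩
    3                       ∎)
  tail≡0 = ∑-small⇒zero (λ i → a (suc i)) (λ i → w (suc i)) (λ i → 2≤w (suc i)) tail≤1
  k≡0 = multiplicity-one k (w zero) tail (2≤w zero) ∑≤3

height : ℤ⁶
height = vec6    0ℤ   -1ℤ    0ℤ   -1ℤ (+ 2)    1ℤ

rayHeight : Ray → ℕ
rayHeight 𝐛 = 6
rayHeight 𝐜 = 3
rayHeight 𝐟 = 3
rayHeight _ = 2

height-ray : ∀ r → dot height (ray r) ≡ + rayHeight r
height-ray = decide (FinP.all? λ r → dot height (ray r) ℤ.≟ + rayHeight r) refl

rayHeight≥2 : ∀ r → 2 ≤ rayHeight r
rayHeight≥2 = decide (FinP.all? λ r → 2 ℕP.≤? rayHeight r) refl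

sumFin-pos : ∀ {n} (f : Fin n → ℕ) → sumFin (λ i → + f i) ≡ + ∑ f
sumFin-pos {zero}  f = refl
sumFin-pos {suc n} f = trans (cong (λ t → + f zero + t) (sumFin-pos (λ i → f (suc i))))
                             (sym (ℤP.pos-+ (f zero) (∑ (λ i → f (suc i)))))

height-lincomb : ∀ {n} (a w : Fin n → ℕ) (g : Fin n → ℤ⁶) → (∀ i → dot height (g i) ≡ + w i) →
                 dot height (lincomb (λ i → + a i) g) ≡ + ∑ (λ i → a i ℕ.* w i)
height-lincomb a w g height-g = begin
  dot height (lincomb (λ i → + a i) g)        ≡⟨ dot-lincomb height (λ i → + a i) g ⟩
  sumFin (λ i → + a i * dot height (g i))     ≡⟨ sumFin-cong (λ i → trans (cong (+ a i *_) (height-g i))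
                                                                       (sym (ℤP.pos-* (a i) (w i)))) ⟩
  sumFin (λ i → + (a i ℕ.* w i))              ≡⟨ sumFin-pos (λ i → a i ℕ.* w i) ⟩
  + ∑ (λ i → a i ℕ.* w i)                     ∎
  where open ≡-Reasoning

lincomb-zero : ∀ {n} (a : Fin n → ℕ) (g : Fin n → ℤ⁶) → (∀ i → a i ≡ 0) → lincomb (λ i → + a i) g ≗ 0⃗
lincomb-zero a g a≡0 j = sumFin-zero (λ i → trans (cong (λ t → + t * g i j) (a≡0 i)) (ℤP.*-zeroˡ (g i j)))

lincomb-unit : ∀ {n} (a : Fin n → ℕ) (g : Fin n → ℤ⁶) i → a i ≡ 1 → (∀ j → j ≢ i → a j ≡ 0) →
               lincomb (λ i → + a i) g ≗ g i
lincomb-unit a g i aᵢ≡1 others≡0 j =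
  sumFin-select (λ i → + a i) (λ i → g i j) i (cong +_ aᵢ≡1) (λ k k≢i → cong +_ (others≡0 k k≢i))

chamberHeight : Fin 18 → Fin 6 → ℕ
chamberHeight k i = rayHeight (chamberRay k i)

height-generator : ∀ k i → dot height (generator k i) ≡ + chamberHeight k i
height-generator k i = trans (dot-cong height (generator≗ray k i)) (height-ray (chamberRay k i))

support-height : ∀ z → C z ≢ + 0 → ¬ (z ≗ 0⃗) → ∃ λ W → dot height z ≡ + W × 2 ≤ W
support-height z Cz≢0 z≢0
  with k , a , z≗ ← K⊆chambers z (support⊆K z Cz≢0)
  with ∑ (λ i → a i ℕ.* chamberHeight k i) ℕP.≤? 1
... | yes ∑≤1 =
      ⊥-elim (z≢0 λ j → trans (z≗ j) (lincomb-zero a (generator k)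
                                        (∑-small⇒zero a (chamberHeight k) (rayHeight≥2 ∘ chamberRay k) ∑≤1) j))
... | no  ∑≰1 =
      _ , trans (dot-cong height z≗) (height-lincomb a (chamberHeight k) (generator k) (height-generator k)) ,
      ℕP.≰⇒> ∑≰1

-- Permutations of the rays that preserve the chambers

∧-sound : ∀ a b → a ∧ b ≡ true → a ≡ true × b ≡ true
∧-sound true b h = refl , h

opaque
  every : ∀ {n} → (Fin n → Bool) → Bool
  every {zero}  p = true
  every {suc n} p = p zero ∧ every (λ i → p (suc i))

  every-sound : ∀ {n} (p : Fin n → Bool) → every p ≡ true → ∀ i → p i ≡ true
  every-sound p h zero    = proj₁ (∧-sound (p zero) _ h)
  every-sound p h (suc i) = every-sound (λ i → p (suc i)) (proj₂ (∧-sound (p zero) _ h)) i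

_⇒ᵇ_ : Bool → Bool → Bool
a ⇒ᵇ b = if a then b else true

⇒ᵇ-sound : ∀ {a b} → (a ⇒ᵇ b) ≡ true → a ≡ true → b ≡ true
⇒ᵇ-sound h refl = h


extend : (Fin 8 → Fin 8) → Ray → Ray
extend ψ 𝐛       = 𝐛
extend ψ (suc e) = suc (ψ e)

firstIndex : ∀ {n} → (Fin (suc n) → Bool) → Fin (suc n)
firstIndex {zero}  p = zero
firstIndex {suc n} p = if p zero then zero else suc (firstIndex (λ i → p (suc i)))

opaque
  position : (Fin 6 → Ray) → Ray → Fin 6
  position v r = firstIndex (λ i → does (v i ≟ r))

permutationOf : (Ray → Ray) → Fin 18 → Fin 18 → Fin 6 → Fin 6
permutationOf φ k k′ l = position (λ i → φ (chamberRay k i)) (chamberRay k′ l)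

inversePermutationOf : (Ray → Ray) → Fin 18 → Fin 18 → Fin 6 → Fin 6
inversePermutationOf φ k k′ i = position (chamberRay k′) (φ (chamberRay k i))

MapsChamber : (Ray → Ray) → Fin 18 → Fin 18 → Set
MapsChamber φ k k′ = (∀ l → chamberRay k′ l ≡ φ (chamberRay k (τ l)))
                   × (∀ i → τ (σ i) ≡ i) × (∀ l → σ (τ l) ≡ l)
  where
  τ = permutationOf φ k k′
  σ = inversePermutationOf φ k k′

mapsChamberᵇ : (Ray → Ray) → Fin 18 → Fin 18 → Bool
mapsChamberᵇ φ k k′ = every (λ l → does (chamberRay k′ l ≟ φ (chamberRay k (τ l))))
                    ∧ every (λ i → does (τ (σ i) ≟ i)) ∧ every (λ l → does (σ (τ l) ≟ l))
  where
  τ = permutationOf φ k k′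
  σ = inversePermutationOf φ k k′

mapsChamberᵇ-sound : ∀ φ k k′ → mapsChamberᵇ φ k k′ ≡ true → MapsChamber φ k k′
mapsChamberᵇ-sound φ k k′ h =
  (λ l → decide (chamberRay k′ l ≟ φ (chamberRay k (τ l)))
                    (every-sound (λ l → does (chamberRay k′ l ≟ φ (chamberRay k (τ l)))) rays l)) ,
  (λ i → decide (τ (σ i) ≟ i) (every-sound (λ i → does (τ (σ i) ≟ i)) τσ i)) ,
  (λ l → decide (σ (τ l) ≟ l) (every-sound (λ l → does (σ (τ l) ≟ l)) στ l))
  where
  τ = permutationOf φ k k′
  σ = inversePermutationOf φ k k′
  raysᵇ = every (λ l → does (chamberRay k′ l ≟ φ (chamberRay k (τ l))))
  τσᵇ   = every (λ i → does (τ (σ i) ≟ i))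
  στᵇ   = every (λ l → does (σ (τ l) ≟ l))
  rays = proj₁ (∧-sound raysᵇ (τσᵇ ∧ στᵇ) h)
  τσ = proj₁ (∧-sound τσᵇ στᵇ (proj₂ (∧-sound raysᵇ (τσᵇ ∧ στᵇ) h)))
  στ = proj₂ (∧-sound τσᵇ στᵇ (proj₂ (∧-sound raysᵇ (τσᵇ ∧ στᵇ) h)))

-- The candidate image of chamber k is found by comparing ray sets, encoded as bit masks;
-- MapsChamber then verifies it.
opaque
  imageChamber : (Ray → Ray) → Fin 18 → Fin 18
  imageChamber φ k = firstIndex (λ k′ → mask (chamberRay k′) ℕ.≡ᵇ mask (λ i → φ (chamberRay k i)))
    where
    mask : (Fin 6 → Ray) → ℕ
    mask v = sumℕ (λ i → 2 ℕ.^ toℕ (v i))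
      where
      sumℕ : ∀ {n} → (Fin n → ℕ) → ℕ
      sumℕ {zero}  f = 0
      sumℕ {suc n} f = f zero ℕ.+ sumℕ (λ i → f (suc i))

PreservesChambers : (Ray → Ray) → Set
PreservesChambers φ = (ray 𝐛 ≗ λ j → ray (φ 𝐜) j + ray (φ 𝐟) j) × ∀ k → MapsChamber φ k (imageChamber φ k)

preservesChambersᵇ : (Ray → Ray) → Bool
preservesChambersᵇ φ = every (λ j → does (ray 𝐛 j ℤ.≟ ray (φ 𝐜) j + ray (φ 𝐟) j))
                     ∧ every (λ k → mapsChamberᵇ φ k (imageChamber φ k))

preservesChambersᵇ-sound : ∀ φ → preservesChambersᵇ φ ≡ true → PreservesChambers φ
preservesChambersᵇ-sound φ h =
  (λ j → decide (ray 𝐛 j ℤ.≟ ray (φ 𝐜) j + ray (φ 𝐟) j) (every-sound 𝐛P (proj₁ parts) j)) ,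
  (λ k → mapsChamberᵇ-sound φ k (imageChamber φ k) (every-sound chamberP (proj₂ parts) k))
  where
  𝐛P : Fin 6 → Bool
  𝐛P j = does (ray 𝐛 j ℤ.≟ ray (φ 𝐜) j + ray (φ 𝐟) j)
  chamberP : Fin 18 → Bool
  chamberP k = mapsChamberᵇ φ k (imageChamber φ k)
  parts = ∧-sound (every 𝐛P) (every chamberP) h

-- A base-8 encoding of the (small, nonnegative) coordinates of the rays; it turns the
-- linear relations among rays used below into equations between natural numbers.
rayCode : Ray → ℕ
rayCode = lookup (78474 ∷ 41545 ∷ 36929 ∷ 36937 ∷ 36873 ∷ 4097 ∷ 37441 ∷ 37440 ∷ 4160 ∷ [])

CodeSum : Ray → Ray → Ray → Ray → Ray → Set
CodeSum p q r s t = rayCode p ℕ.+ rayCode q ≡ rayCode r ℕ.+ rayCode s ℕ.+ rayCode t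

rayCode-dot : ∀ r → dot (vec6 (+ 1) (+ 8) (+ 64) (+ 512) (+ 4096) (+ 32768)) (ray r) ≡ + rayCode r
rayCode-dot = decide (FinP.all? λ r → dot (vec6 (+ 1) (+ 8) (+ 64) (+ 512) (+ 4096) (+ 32768)) (ray r) ℤ.≟ + rayCode r) refl

code-sum : ∀ p q r s t → (∀ j → ray p j + ray q j ≡ ray r j + ray s j + ray t j) → CodeSum p q r s t
code-sum p q r s t sum≗ = ℤP.+-injective (begin
  + (rayCode p ℕ.+ rayCode q)                           ≡⟨ cong₂ _+_ (rayCode-dot p) (rayCode-dot q) ⟨
  dot κ (ray p) + dot κ (ray q)                         ≡⟨ dot-+ κ (ray p) (ray q) ⟨
  dot κ (λ j → ray p j + ray q j)                       ≡⟨ dot-cong κ sum≗ ⟩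
  dot κ (λ j → ray r j + ray s j + ray t j)             ≡⟨ dot-+ κ (λ j → ray r j + ray s j) (ray t) ⟩
  dot κ (λ j → ray r j + ray s j) + dot κ (ray t)       ≡⟨ cong (_+ dot κ (ray t)) (dot-+ κ (ray r) (ray s)) ⟩
  dot κ (ray r) + dot κ (ray s) + dot κ (ray t)         ≡⟨ cong₂ _+_ (cong₂ _+_ (rayCode-dot r) (rayCode-dot s)) (rayCode-dot t) ⟩
  + (rayCode r ℕ.+ rayCode s ℕ.+ rayCode t)             ∎)
  where
  open ≡-Reasoning
  κ = vec6 (+ 1) (+ 8) (+ 64) (+ 512) (+ 4096) (+ 32768)

codeSumᵇ : Ray → Ray → Ray → Ray → Ray → Bool
codeSumᵇ p q r s t = rayCode p ℕ.+ rayCode q ℕ.≡ᵇ rayCode r ℕ.+ rayCode s ℕ.+ rayCode t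

images : (c′ f′ d₁′ e₁′ g₁′ d₂′ e₂′ g₂′ : Fin 8) → Fin 8 → Fin 8
images c′ f′ d₁′ e₁′ g₁′ d₂′ e₂′ g₂′ = lookup (c′ ∷ f′ ∷ d₁′ ∷ e₁′ ∷ g₁′ ∷ d₂′ ∷ e₂′ ∷ g₂′ ∷ [])

distinctᵇ : Fin 8 → Fin 8 → Bool
distinctᵇ e e′ = not (does (e ≟ e′))

-- The images of the rays satisfy 𝐜 + 𝐟 = 𝐝₁ + 𝐠₁ + 𝐞₂ = 𝐞₁ + 𝐝₂ + 𝐠₂; the first relation
-- involves only five of them, which prunes the search.
secondBlockᵇ : (c′ f′ d₁′ g₁′ e₂′ e₁′ d₂′ g₂′ : Fin 8) → Bool
secondBlockᵇ c′ f′ d₁′ g₁′ e₂′ e₁′ d₂′ g₂′ =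
  codeSumᵇ (suc c′) (suc f′) (suc e₁′) (suc d₂′) (suc g₂′) ⇒ᵇ
  ((distinctᵇ e₁′ d₁′ ∧ distinctᵇ e₁′ g₁′ ∧ distinctᵇ e₁′ e₂′) ⇒ᵇ
   preservesChambersᵇ (extend (images c′ f′ d₁′ e₁′ g₁′ d₂′ e₂′ g₂′)))

firstBlockᵇ : (c′ f′ d₁′ g₁′ e₂′ : Fin 8) → Bool
firstBlockᵇ c′ f′ d₁′ g₁′ e₂′ =
  codeSumᵇ (suc c′) (suc f′) (suc d₁′) (suc g₁′) (suc e₂′) ⇒ᵇ
  (every λ e₁′ → every λ d₂′ → every λ g₂′ → secondBlockᵇ c′ f′ d₁′ g₁′ e₂′ e₁′ d₂′ g₂′)

opaque
  unfolding every position imageChamber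
  search-passes : every (λ c′ → every λ f′ → every λ d₁′ → every λ g₁′ → every λ e₂′ → firstBlockᵇ c′ f′ d₁′ g₁′ e₂′)
                  ≡ true
  search-passes = refl

codeSumᵇ-complete : ∀ p q r s t → CodeSum p q r s t → codeSumᵇ p q r s t ≡ true
codeSumᵇ-complete p q r s t eq = Equivalence.to T-≡ (ℕP.≡⇒≡ᵇ _ _ eq)

distinctᵇ-complete : ∀ {e e′} → e ≢ e′ → distinctᵇ e e′ ≡ true
distinctᵇ-complete {e} {e′} e≢e′ with e ≟ e′
... | yes e≡e′ = ⊥-elim (e≢e′ e≡e′)
... | no _     = refl

ray-images-preserve-chambers :
  ∀ c′ f′ d₁′ g₁′ e₂′ → CodeSum (suc c′) (suc f′) (suc d₁′) (suc g₁′) (suc e₂′) →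
  ∀ e₁′ d₂′ g₂′ → CodeSum (suc c′) (suc f′) (suc e₁′) (suc d₂′) (suc g₂′) →
  e₁′ ≢ d₁′ → e₁′ ≢ g₁′ → e₁′ ≢ e₂′ →
  PreservesChambers (extend (images c′ f′ d₁′ e₁′ g₁′ d₂′ e₂′ g₂′))
ray-images-preserve-chambers c′ f′ d₁′ g₁′ e₂′ sum₁ e₁′ d₂′ g₂′ sum₂ e₁≢d₁ e₁≢g₁ e₁≢e₂ =
  preservesChambersᵇ-sound (extend (images c′ f′ d₁′ e₁′ g₁′ d₂′ e₂′ g₂′))
    (⇒ᵇ-sound (⇒ᵇ-sound second (codeSumᵇ-complete (suc c′) (suc f′) (suc e₁′) (suc d₂′) (suc g₂′) sum₂)) distinct)
  where
  level₁ : every (λ f′ → every λ d₁′ → every λ g₁′ → every λ e₂′ → firstBlockᵇ c′ f′ d₁′ g₁′ e₂′) ≡ true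
  level₁ = every-sound (λ c′ → every λ f′ → every λ d₁′ → every λ g₁′ → every λ e₂′ → firstBlockᵇ c′ f′ d₁′ g₁′ e₂′)
                       search-passes c′
  level₂ : every (λ d₁′ → every λ g₁′ → every λ e₂′ → firstBlockᵇ c′ f′ d₁′ g₁′ e₂′) ≡ true
  level₂ = every-sound (λ f′ → every λ d₁′ → every λ g₁′ → every λ e₂′ → firstBlockᵇ c′ f′ d₁′ g₁′ e₂′) level₁ f′
  level₃ : every (λ g₁′ → every λ e₂′ → firstBlockᵇ c′ f′ d₁′ g₁′ e₂′) ≡ true
  level₃ = every-sound (λ d₁′ → every λ g₁′ → every λ e₂′ → firstBlockᵇ c′ f′ d₁′ g₁′ e₂′) level₂ d₁′
  level₄ : every (λ e₂′ → firstBlockᵇ c′ f′ d₁′ g₁′ e₂′) ≡ true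
  level₄ = every-sound (λ g₁′ → every λ e₂′ → firstBlockᵇ c′ f′ d₁′ g₁′ e₂′) level₃ g₁′
  first : every (λ e₁′ → every λ d₂′ → every λ g₂′ → secondBlockᵇ c′ f′ d₁′ g₁′ e₂′ e₁′ d₂′ g₂′) ≡ true
  first = ⇒ᵇ-sound (every-sound (firstBlockᵇ c′ f′ d₁′ g₁′) level₄ e₂′) (codeSumᵇ-complete (suc c′) (suc f′) (suc d₁′) (suc g₁′) (suc e₂′) sum₁)
  second : secondBlockᵇ c′ f′ d₁′ g₁′ e₂′ e₁′ d₂′ g₂′ ≡ true
  second = every-sound (secondBlockᵇ c′ f′ d₁′ g₁′ e₂′ e₁′ d₂′)
             (every-sound (λ d₂′ → every (secondBlockᵇ c′ f′ d₁′ g₁′ e₂′ e₁′ d₂′))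
               (every-sound (λ e₁′ → every λ d₂′ → every (secondBlockᵇ c′ f′ d₁′ g₁′ e₂′ e₁′ d₂′)) first e₁′) d₂′) g₂′
  distinct : (distinctᵇ e₁′ d₁′ ∧ distinctᵇ e₁′ g₁′ ∧ distinctᵇ e₁′ e₂′) ≡ true
  distinct rewrite distinctᵇ-complete e₁≢d₁ | distinctᵇ-complete e₁≢g₁ | distinctᵇ-complete e₁≢e₂ = refl

∈Cell-cong : ∀ {x y} c → x ≗ y → x ∈Cell c → y ∈Cell c
∈Cell-cong c x≗y (d , a , outside≡0 , eq) = d , a , outside≡0 , λ j → trans (cong (+ suc d *_) (sym (x≗y j))) (eq j)

∈Cell-image : ∀ L k k′ (S S′ : Subset 6) (π π⁻¹ : Fin 6 → Fin 6) →
              (∀ i → π (π⁻¹ i) ≡ i) → (∀ l → π⁻¹ (π l) ≡ l) →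
              (∀ l → applyMat L (generator k (π l)) ≗ generator k′ l) → (∀ l → lookup S′ l ≡ lookup S (π l)) →
              ∀ x → x ∈Cell (k , S) → applyMat L x ∈Cell (k′ , S′)
∈Cell-image L k k′ S S′ π π⁻¹ ππ⁻¹ π⁻¹π L-gen S′≡ x (d , a , outside≡0 , eq) =
  d , (λ l → a (π l)) , (λ l l∉S′ → outside≡0 (π l) (trans (sym (S′≡ l)) l∉S′)) , λ j → begin
    + suc d * applyMat L x j                                   ≡⟨ applyMat-* L (+ suc d) x j ⟨
    applyMat L (λ j → + suc d * x j) j                         ≡⟨ applyMat-cong L eq j ⟩
    applyMat L (lincomb (λ i → + a i) (generator k)) j        ≡⟨ applyMat-lincomb L (λ i → + a i) (generator k) j ⟩
    sumFin (λ i → + a i * applyMat L (generator k i) j)        ≡⟨ sumFin-permute (λ i → + a i * applyMat L (generator k i) j) π π⁻¹ ππ⁻¹ π⁻¹π ⟨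
    sumFin (λ l → + a (π l) * applyMat L (generator k (π l)) j) ≡⟨ sumFin-cong (λ l → cong (+ a (π l) *_) (L-gen l j)) ⟩
    sumFin (λ l → + a (π l) * generator k′ l j)                ∎
  where open ≡-Reasoning

-- Linear symmetries of C

C-cong : ∀ {x y} → x ≗ y → C x ≡ C y
C-cong {x} {y} x≗y = vec6-cong (x≗y zero) (x≗y (suc zero)) (x≗y (suc (suc zero))) (x≗y (suc (suc (suc zero))))
                               (x≗y (suc (suc (suc (suc zero))))) (x≗y (suc (suc (suc (suc (suc zero))))))
  where
  vec6-cong : ∀ {a b c d e f a′ b′ c′ d′ e′ f′} → a ≡ a′ → b ≡ b′ → c ≡ c′ → d ≡ d′ → e ≡ e′ → f ≡ f′ →
              C (vec6 a b c d e f) ≡ C (vec6 a′ b′ c′ d′ e′ f′)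
  vec6-cong refl refl refl refl refl refl = refl

C-ray≢0 : ∀ r → C (ray r) ≢ + 0
C-ray≢0 = decide (FinP.all? λ r → ¬? (C (ray r) ℤ.≟ + 0)) refl

ray≢0 : ∀ r → ¬ (ray r ≗ 0⃗)
ray≢0 r ray≗0 = ν₁≢0 r (ray≗0 (suc (suc (suc (suc zero)))))
  where
  ν₁≢0 : ∀ r → ray r (suc (suc (suc (suc zero)))) ≢ + 0
  ν₁≢0 = decide (FinP.all? λ r → ¬? (ray r (suc (suc (suc (suc zero)))) ℤ.≟ + 0)) refl

ray𝐛≗ray𝐜+ray𝐟 : ray 𝐛 ≗ λ j → ray 𝐜 j + ray 𝐟 j
ray𝐛≗ray𝐜+ray𝐟 = decide (FinP.all? λ j → ray 𝐛 j ℤ.≟ ray 𝐜 j + ray 𝐟 j) refl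

rayHeight≤3 : ∀ e → rayHeight (suc e) ≤ 3
rayHeight≤3 = decide (FinP.all? λ e → rayHeight (suc e) ℕP.≤? 3) refl

ray-injective : ∀ r r′ → ray r ≗ ray r′ → r ≡ r′
ray-injective = decide (FinP.all? λ r → FinP.all? λ r′ → FinP.all? (λ j → ray r j ℤ.≟ ray r′ j) →-dec r FinP.≟ r′) refl

module LinearSymmetry (A B : Mat)
                      (AB : ∀ x → applyMat A (applyMat B x) ≗ x) (BA : ∀ x → applyMat B (applyMat A x) ≗ x)
                      (C∘A : ∀ x → C (applyMat A x) ≡ C x) where

  C∘B : ∀ x → C (applyMat B x) ≡ C x
  C∘B x = trans (sym (C∘A (applyMat B x))) (C-cong (AB x))

  A-ray-height : ∀ r → ∃ λ W → dot height (applyMat A (ray r)) ≡ + W × 2 ≤ W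
  A-ray-height r = support-height (applyMat A (ray r)) (λ C≡0 → C-ray≢0 r (trans (sym (C∘A (ray r))) C≡0))
                     (λ Ar≗0 → ray≢0 r (λ j → trans (sym (BA (ray r) j))
                                           (trans (applyMat-cong B Ar≗0 j) (applyMat-zero B j))))

  W : Ray → ℕ
  W r = proj₁ (A-ray-height r)

  A-lincomb-rays : ∀ r k (a : Fin 6 → ℕ) → applyMat B (ray r) ≗ lincomb (λ i → + a i) (generator k) →
                   ray r ≗ lincomb (λ i → + a i) (λ i → applyMat A (ray (chamberRay k i)))
  A-lincomb-rays r k a Br≗ j = begin
    ray r j                                                        ≡⟨ AB (ray r) j ⟨
    applyMat A (applyMat B (ray r)) j                              ≡⟨ applyMat-cong A Br≗ j ⟩
    applyMat A (lincomb (λ i → + a i) (generator k)) j             ≡⟨ applyMat-lincomb A (λ i → + a i) (generator k) j ⟩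
    lincomb (λ i → + a i) (λ i → applyMat A (generator k i)) j     ≡⟨ sumFin-cong (λ i → cong (+ a i *_)
                                                                        (applyMat-cong A (generator≗ray k i) j)) ⟩
    lincomb (λ i → + a i) (λ i → applyMat A (ray (chamberRay k i))) j ∎
    where open ≡-Reasoning

  weighted-height≤3 : ∀ e k (a : Fin 6 → ℕ) → applyMat B (ray (suc e)) ≗ lincomb (λ i → + a i) (generator k) →
                      ∑ (λ i → a i ℕ.* W (chamberRay k i)) ≤ 3
  weighted-height≤3 e k a Br≗ = subst (_≤ 3) (ℤP.+-injective height≡) (rayHeight≤3 e)
    where
    height≡ : + rayHeight (suc e) ≡ + ∑ (λ i → a i ℕ.* W (chamberRay k i))
    height≡ = begin
      + rayHeight (suc e)     ≡⟨ height-ray (suc e) ⟨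
      dot height (ray (suc e)) ≡⟨ dot-cong height (A-lincomb-rays (suc e) k a Br≗) ⟩
      dot height (lincomb (λ i → + a i) (λ i → applyMat A (ray (chamberRay k i))))
                               ≡⟨ height-lincomb a (W ∘ chamberRay k) (λ i → applyMat A (ray (chamberRay k i)))
                                                 (proj₁ ∘ proj₂ ∘ A-ray-height ∘ chamberRay k) ⟩
      + ∑ (λ i → a i ℕ.* W (chamberRay k i)) ∎
      where open ≡-Reasoning

  -- B sends a ray other than 𝐛 to a generator of some chamber: applying A to the chamber
  -- coordinates of its image writes the ray as a combination of points of height ≥ 2,
  -- while the ray itself has height ≤ 3.
  B-ray-generator : ∀ e → ∃ λ k → ∃ λ i → applyMat B (ray (suc e)) ≗ ray (chamberRay k i)
  B-ray-generator e = from-chamber (K⊆chambers Br (support⊆K Br C≢0))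
    where
    Br : ℤ⁶
    Br = applyMat B (ray (suc e))
    C≢0 : C Br ≢ + 0
    C≢0 C≡0 = C-ray≢0 (suc e) (trans (sym (C∘B (ray (suc e)))) C≡0)
    Ag : Fin 18 → Fin 6 → ℤ⁶
    Ag k i = applyMat A (ray (chamberRay k i))
    from-unit : ∀ k a → Br ≗ lincomb (λ i → + a i) (generator k) →
                (∀ i → a i ≡ 0) ⊎ (∃ λ i → a i ≡ 1 × ∀ j → j ≢ i → a j ≡ 0) →
                ∃ λ k → ∃ λ i → Br ≗ ray (chamberRay k i)
    from-unit k a Br≗ (inj₁ a≡0) =
      ⊥-elim (ray≢0 (suc e) (λ j → trans (A-lincomb-rays (suc e) k a Br≗ j) (lincomb-zero a (Ag k) a≡0 j)))
    from-unit k a Br≗ (inj₂ (i , aᵢ≡1 , others≡0)) =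
      k , i , λ j → trans (Br≗ j) (trans (lincomb-unit a (generator k) i aᵢ≡1 others≡0 j) (generator≗ray k i j))
    from-chamber : (∃ λ k → InChamber k Br) → ∃ λ k → ∃ λ i → Br ≗ ray (chamberRay k i)
    from-chamber (k , a , Br≗) =
      from-unit k a Br≗ (∑-small⇒unit a (λ i → W (chamberRay k i)) (λ i → proj₂ (proj₂ (A-ray-height (chamberRay k i))))
                                     (weighted-height≤3 e k a Br≗))

  B-ray-not-𝐛 : ∀ e → ¬ (applyMat B (ray (suc e)) ≗ ray 𝐛)
  B-ray-not-𝐛 e Br≗b = 4≰3 (begin
    4                      ≤⟨ ℕP.+-mono-≤ (proj₂ (proj₂ (A-ray-height 𝐜))) (proj₂ (proj₂ (A-ray-height 𝐟))) ⟩
    W 𝐜 ℕ.+ W 𝐟             ≡⟨ ℤP.+-injective height≡ ⟨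
    rayHeight (suc e)       ≤⟨ rayHeight≤3 e ⟩
    3                       ∎)
    where
    open ℕP.≤-Reasoning
    r≗Ac+Af : ray (suc e) ≗ λ j → applyMat A (ray 𝐜) j + applyMat A (ray 𝐟) j
    r≗Ac+Af j = trans (sym (AB (ray (suc e)) j))
                (trans (applyMat-cong A Br≗b j)
                (trans (applyMat-cong A ray𝐛≗ray𝐜+ray𝐟 j) (applyMat-+ A (ray 𝐜) (ray 𝐟) j)))
    height≡ : + rayHeight (suc e) ≡ + (W 𝐜 ℕ.+ W 𝐟)
    height≡ = trans (sym (height-ray (suc e)))
              (trans (dot-cong height r≗Ac+Af)
              (trans (dot-+ height (applyMat A (ray 𝐜)) (applyMat A (ray 𝐟)))
                     (cong₂ _+_ (proj₁ (proj₂ (A-ray-height 𝐜))) (proj₁ (proj₂ (A-ray-height 𝐟))))))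

  opaque
    B-ray : ∀ e → ∃ λ e′ → applyMat B (ray (suc e)) ≗ ray (suc e′)
    B-ray e = from-generator (B-ray-generator e)
      where
      from-generator : (∃ λ k → ∃ λ i → applyMat B (ray (suc e)) ≗ ray (chamberRay k i)) →
                       ∃ λ e′ → applyMat B (ray (suc e)) ≗ ray (suc e′)
      from-generator (k , i , Br≗) with chamberRay k i
      ... | 𝐛      = ⊥-elim (B-ray-not-𝐛 e Br≗)
      ... | suc e′ = e′ , Br≗

  jm : Fin 8 → Fin 8
  jm e = proj₁ (B-ray e)

  B-ray-jm : ∀ e → applyMat B (ray (suc e)) ≗ ray (suc (jm e))
  B-ray-jm e = proj₂ (B-ray e)

  φ : Ray → Ray
  φ = extend (images (jm (# 0)) (jm (# 1)) (jm (# 2)) (jm (# 3)) (jm (# 4)) (jm (# 5)) (jm (# 6)) (jm (# 7)))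

  B-ray-sum : ∀ p q r s t → (∀ j → ray (suc p) j + ray (suc q) j ≡ ray (suc r) j + ray (suc s) j + ray (suc t) j) →
              CodeSum (suc (jm p)) (suc (jm q)) (suc (jm r)) (suc (jm s)) (suc (jm t))
  B-ray-sum p q r s t sum≗ = code-sum (suc (jm p)) (suc (jm q)) (suc (jm r)) (suc (jm s)) (suc (jm t)) λ j → begin
    ray (suc (jm p)) j + ray (suc (jm q)) j
      ≡⟨ cong₂ _+_ (B-ray-jm p j) (B-ray-jm q j) ⟨
    applyMat B (ray (suc p)) j + applyMat B (ray (suc q)) j
      ≡⟨ applyMat-+ B (ray (suc p)) (ray (suc q)) j ⟨
    applyMat B (λ j → ray (suc p) j + ray (suc q) j) j
      ≡⟨ applyMat-cong B sum≗ j ⟩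
    applyMat B (λ j → ray (suc r) j + ray (suc s) j + ray (suc t) j) j
      ≡⟨ applyMat-+ B (λ j → ray (suc r) j + ray (suc s) j) (ray (suc t)) j ⟩
    applyMat B (λ j → ray (suc r) j + ray (suc s) j) j + applyMat B (ray (suc t)) j
      ≡⟨ cong (_+ applyMat B (ray (suc t)) j) (applyMat-+ B (ray (suc r)) (ray (suc s)) j) ⟩
    applyMat B (ray (suc r)) j + applyMat B (ray (suc s)) j + applyMat B (ray (suc t)) j
      ≡⟨ cong₂ _+_ (cong₂ _+_ (B-ray-jm r j) (B-ray-jm s j)) (B-ray-jm t j) ⟩
    ray (suc (jm r)) j + ray (suc (jm s)) j + ray (suc (jm t)) j ∎
    where open ≡-Reasoning

  jm-injective : ∀ e e′ → jm e ≡ jm e′ → e ≡ e′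
  jm-injective e e′ jm≡ = FinP.suc-injective (ray-injective (suc e) (suc e′) λ j → begin
    ray (suc e) j                          ≡⟨ AB (ray (suc e)) j ⟨
    applyMat A (applyMat B (ray (suc e))) j ≡⟨ applyMat-cong A (B-ray-jm e) j ⟩
    applyMat A (ray (suc (jm e))) j        ≡⟨ cong (λ e″ → applyMat A (ray (suc e″)) j) jm≡ ⟩
    applyMat A (ray (suc (jm e′))) j       ≡⟨ applyMat-cong A (B-ray-jm e′) j ⟨
    applyMat A (applyMat B (ray (suc e′))) j ≡⟨ AB (ray (suc e′)) j ⟩
    ray (suc e′) j                         ∎)
    where open ≡-Reasoning

  φ-preserves-chambers : PreservesChambers φ
  φ-preserves-chambers =
    ray-images-preserve-chambers (jm (# 0)) (jm (# 1)) (jm (# 2)) (jm (# 4)) (jm (# 6)) (B-ray-sum (# 0) (# 1) (# 2) (# 4) (# 6) (decide (sum? (# 2) (# 4) (# 6)) refl))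
                                 (jm (# 3)) (jm (# 5)) (jm (# 7)) (B-ray-sum (# 0) (# 1) (# 3) (# 5) (# 7) (decide (sum? (# 3) (# 5) (# 7)) refl))
                                 (λ eq → 3≢2 (jm-injective (# 3) (# 2) eq)) (λ eq → 3≢4 (jm-injective (# 3) (# 4) eq))
                                 (λ eq → 3≢6 (jm-injective (# 3) (# 6) eq))
    where
    sum? : ∀ r s t → Dec (∀ j → ray 𝐜 j + ray 𝐟 j ≡ ray (suc r) j + ray (suc s) j + ray (suc t) j)
    sum? r s t = FinP.all? λ j → ray 𝐜 j + ray 𝐟 j ℤ.≟ ray (suc r) j + ray (suc s) j + ray (suc t) j
    3≢2 : _≢_ {A = Fin 8} (# 3) (# 2)
    3≢2 ()
    3≢4 : _≢_ {A = Fin 8} (# 3) (# 4)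
    3≢4 ()
    3≢6 : _≢_ {A = Fin 8} (# 3) (# 6)
    3≢6 ()

  B-ray-φ : ∀ r → applyMat B (ray r) ≗ ray (φ r)
  B-ray-φ (suc e) j = trans (B-ray-jm e j) (cong (λ e′ → ray (suc e′) j) (sym (VecP.lookup∘tabulate jm e)))
  B-ray-φ 𝐛 j = begin
    applyMat B (ray 𝐛) j                            ≡⟨ applyMat-cong B ray𝐛≗ray𝐜+ray𝐟 j ⟩
    applyMat B (λ j → ray 𝐜 j + ray 𝐟 j) j         ≡⟨ applyMat-+ B (ray 𝐜) (ray 𝐟) j ⟩
    applyMat B (ray 𝐜) j + applyMat B (ray 𝐟) j    ≡⟨ cong₂ _+_ (B-ray-φ 𝐜 j) (B-ray-φ 𝐟 j) ⟩
    ray (φ 𝐜) j + ray (φ 𝐟) j                      ≡⟨ proj₁ φ-preserves-chambers j ⟨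
    ray 𝐛 j                                         ∎
    where open ≡-Reasoning

  B-maps-cells : ∀ c → Σ Cell λ c′ → MapsOnto (applyMat B) c c′
  B-maps-cells (k , S) = (k′ , S′) , λ x → mk⇔ (∈Cell-image B k k′ S S′ τ σ τσ στ B-gen S′≡ x) (backward x)
    where
    k′ = imageChamber φ k
    τ  = permutationOf φ k k′
    σ  = inversePermutationOf φ k k′
    rays : ∀ l → chamberRay k′ l ≡ φ (chamberRay k (τ l))
    rays = proj₁ (proj₂ φ-preserves-chambers k)
    τσ : ∀ i → τ (σ i) ≡ i
    τσ = proj₁ (proj₂ (proj₂ φ-preserves-chambers k))
    στ : ∀ l → σ (τ l) ≡ l
    στ = proj₂ (proj₂ (proj₂ φ-preserves-chambers k))
    S′ : Subset 6
    S′ = tabulate (λ l → lookup S (τ l))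
    S′≡ : ∀ l → lookup S′ l ≡ lookup S (τ l)
    S′≡ = VecP.lookup∘tabulate (λ l → lookup S (τ l))
    B-gen : ∀ l → applyMat B (generator k (τ l)) ≗ generator k′ l
    B-gen l j = begin
      applyMat B (generator k (τ l)) j    ≡⟨ applyMat-cong B (generator≗ray k (τ l)) j ⟩
      applyMat B (ray (chamberRay k (τ l))) j ≡⟨ B-ray-φ (chamberRay k (τ l)) j ⟩
      ray (φ (chamberRay k (τ l))) j      ≡⟨ cong (λ r → ray r j) (rays l) ⟨
      ray (chamberRay k′ l) j             ≡⟨ generator≗ray k′ l j ⟨
      generator k′ l j                    ∎
      where open ≡-Reasoning
    A-gen : ∀ i → applyMat A (generator k′ (σ i)) ≗ generator k i
    A-gen i j = begin
      applyMat A (generator k′ (σ i)) j                ≡⟨ applyMat-cong A (λ j → trans (sym (B-gen (σ i) j))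
                                                             (cong (λ i′ → applyMat B (generator k i′) j) (τσ i))) j ⟩
      applyMat A (applyMat B (generator k i)) j         ≡⟨ AB (generator k i) j ⟩
      generator k i j                                   ∎
      where open ≡-Reasoning
    backward : ∀ x → applyMat B x ∈Cell (k′ , S′) → x ∈Cell (k , S)
    backward x Bx∈ = ∈Cell-cong (k , S) (AB x)
      (∈Cell-image A k′ k S′ S σ τ στ τσ A-gen (λ i → trans (cong (lookup S) (sym (τσ i))) (sym (S′≡ (σ i))))
                   (applyMat B x) Bx∈)

lemma1 : (M N : Mat) → IsInverse M N →
         (∀ x → C (applyMat M x) ≡ C x) →
         (∀ σ → Σ Cell λ τ → MapsOnto (applyMat M) σ τ) ×
         (∀ τ → Σ Cell λ σ → MapsOnto (applyMat M) σ τ)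
lemma1 M N (MN≡I , NM≡I) C∘M = LinearSymmetry.B-maps-cells N M N∘M M∘N C∘N , preimage
  where
  M∘N : ∀ x → applyMat M (applyMat N x) ≗ x
  M∘N = applyMat-inverse M N MN≡I
  N∘M : ∀ x → applyMat N (applyMat M x) ≗ x
  N∘M = applyMat-inverse N M NM≡I
  C∘N : ∀ x → C (applyMat N x) ≡ C x
  C∘N x = trans (sym (C∘M (applyMat N x))) (C-cong (M∘N x))
  preimage : ∀ τ → Σ Cell λ σ → MapsOnto (applyMat M) σ τ
  preimage τ = converse (LinearSymmetry.B-maps-cells M N M∘N N∘M C∘M τ)
    where
    converse : (Σ Cell λ σ → MapsOnto (applyMat N) τ σ) → Σ Cell λ σ → MapsOnto (applyMat M) σ τ
    converse (σ , N-maps) =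
      σ , λ x → mk⇔ (λ x∈σ → Equivalence.from (N-maps (applyMat M x)) (∈Cell-cong σ (λ j → sym (N∘M x j)) x∈σ))
                    (λ Mx∈τ → ∈Cell-cong σ (N∘M x) (Equivalence.to (N-maps (applyMat M x)) Mx∈τ))
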